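{- Let $N$ be an orchard (complete, binary) $\mathcal{L}$-network, and suppose that $h_i$ and $h_e$ are parallel edges in $N$. Then: (1) if $S=s_1\dots s_k$ is a complete reduction sequence for $N$, there exists $i\in[k]$ such that $N^{s_1\dots s_{i-1}}$ has, as one of its connected components, a network isomorphic (up to leaf labels) to the network $N_2$ described below, and this component contains $h_i$ and $h_e$; (2) $h_i,h_e\in\mathrm{adm}(T)$ for some unresolved root component $T$ of $N$.
   Context: Networks. A semidirected graph $N=(V,E)$ has a finite node set and a finite multiset of edges $E=E_U\sqcup E_D$ (parallel edges allowed); edges in $E_U$ are undirected, each edge in $E_D$ is directed from parent to child, written $u\to v$. $\deg_i(v)$, $\deg_o(v)$, $\deg_u(v)$ count directed edges into $v$, out of $v$, and undirected edges at $v$; $\deg(v)$ is their sum. $v$ is a root if $\deg_i(v)=\deg_u(v)=0$, a leaf if $\deg_o(v)=\deg_u(v)=0$, a tree node if $\deg_i(v)\le1$, hybrid if $\deg_i(v)>1$. A path (cycle) is semidirected if its undirected edges can be oriented to make it directed; an SDAG has no semidirected cycle. $N$ is binary if roots have degree 0, 2 or 3, leaves degree 0 or 1, other nodes degree 3. For $\mathcal{L}=[n]$, an $\mathcal{L}$-network is an SDAG whose leaves are tree nodes, with an injective labelling of leaves by $\mathcal{L}$. $u\sim v$ if joined by a path of undirected edges; $N/{\sim}$ contracts all undirected edges. $N$ is complete if edges at leaves are directed towards leaves and no $\sim$-class with more than one node has an incoming directed edge in $N/{\sim}$. A root component is the subgraph induced by a $\sim$-class that is a root of $N/{\sim}$;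 it is trivial if it is a single node, resolved if trivial with that node of degree 0 or 2, and unresolved otherwise. $\mathrm{adm}(T)$ is the set of edges of $T$ together with all edges incident to a node of $T$. A trivial forest consists only of isolated labelled nodes. Parallel edges are two distinct edges with the same two endpoints. Cherries. For non-isolated leaves $a\neq b$ with parents $p_a,p_b$: $(a,b)$ is a tree cherry if $p_a=p_b$, a reticulate cherry if $p_a$ is hybrid and $p_b$ is a parent of $p_a$. A non-leaf node $v$ is suppressible if $\deg(v)=2$ and $\{v\}$ is not a root component, or $\deg(v)=1$, $\{v\}$ is a root component and its child is a tree node; suppressing deletes $v$ and its edges and, if $\deg(v)=2$ with neighbours $u,w$, adds an edge $uw$, directed $u\to w$ if $v$ was incident to a directed edge $v\to w$, undirected otherwise. $N^{(a,b)}$: for a tree cherry delete $a$ and its edge, then suppress $p_a$ if suppressible; for a reticulate cherry delete $p_b\to p_a$, suppress $p_b$ if suppressible, then suppress $p_a$. Edges not involved in a reduction persist in the reduced network. A reduction sequence $s_1\dots s_k$ has each $s_i$ a cherry of $N^{s_1\dots s_{i-1}}$; it is complete if $N^{s_1\dots s_k}$ is a trivial forest; $N$ is orchard if a complete reduction sequence exists. $N_2$ is the $[2]$-network with a root $u$, a hybrid node $v$, leaves $1$ and $2$, and edges $u\to 2$, two parallel directed edges $u\to v$, and $v\to 1$. -}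

module Defs where

open import Data.Nat using (ℕ; zero; suc; _+_; _≤_; _≡ᵇ_)
open import Data.Bool using (Bool; true; false; _∧_; _∨_; not; if_then_else_)
open import Data.Fin using (Fin)
open import Data.Maybe using (Maybe; just; nothing)
open import Data.List using (List; []; _∷_; _++_; length; filterᵇ; map)
open import Data.List.Membership.Propositional using (_∈_)
open import Data.List.Relation.Unary.Any using (Any)
open import Data.List.Relation.Unary.Unique.Propositional using (Unique)
open import Data.Product using (Σ; ∃; ∃-syntax; _×_; _,_)
open import Data.Sum using (_⊎_)
open import Data.Empty using (⊥)
open import Relation.Nullary using (¬_)
open import Relation.Binary.PropositionalEquality using (_≡_; _≢_)
open import Relation.Binary.Construct.Closure.ReflexiveTransitive using (Star)

-- Edges of the input network carry identities
-- 'base k'.  Suppressing a node of degree 2 replaces its two edges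
-- e₁ e₂ by one new edge with identity 'mrg (eid e₁) (eid e₂)'; edges not
-- involved in a reduction keep their identity (and endpoints), so they
-- "persist" in the reduced network.

data EId : Set where
  base : ℕ → EId
  mrg  : EId → EId → EId

_==ᴱ_ : EId → EId → Bool
base m   ==ᴱ base n   = m ≡ᵇ n
mrg a b  ==ᴱ mrg c d  = (a ==ᴱ c) ∧ (b ==ᴱ d)
base _   ==ᴱ mrg _ _  = false
mrg _ _  ==ᴱ base _   = false

IsBase : EId → Set
IsBase (base _)  = Data.Unit.⊤ where import Data.Unit
IsBase (mrg _ _) = ⊥

-- An edge between nodes s and t (nodes are natural numbers).
-- If dir = true the edge is directed s → t, otherwise it is undirected.
record Edge : Set where
  constructor edge
  field
    eid : EId
    s   : ℕ
    t   : ℕ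
    dir : Bool
open Edge public

-- A semidirected (multi)graph with (possibly partial) leaf labelling by
-- L = Fin n.  Parallel edges are distinct list entries with distinct eids.
record Net (n : ℕ) : Set where
  constructor net
  field
    nodes : List ℕ
    edges : List Edge
    lab   : ℕ → Maybe (Fin n)
open Net public

module _ {n : ℕ} (N : Net n) where

  incidentᵇ : ℕ → Edge → Bool
  incidentᵇ v e = (s e ≡ᵇ v) ∨ (t e ≡ᵇ v)

  indeg outdeg udeg deg : ℕ → ℕ
  indeg  v = length (filterᵇ (λ e → dir e ∧ (t e ≡ᵇ v)) (edges N))
  outdeg v = length (filterᵇ (λ e → dir e ∧ (s e ≡ᵇ v)) (edges N))
  udeg   v = length (filterᵇ (λ e → not (dir e) ∧ (s e ≡ᵇ v)) (edges N))
           + length (filterᵇ (λ e → not (dir e) ∧ (t e ≡ᵇ v)) (edges N))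
  deg    v = indeg v + outdeg v + udeg v

  IsRoot IsLeaf IsTreeNode IsHybrid : ℕ → Set
  IsRoot v     = indeg v ≡ 0 × udeg v ≡ 0
  IsLeaf v     = outdeg v ≡ 0 × udeg v ≡ 0
  IsTreeNode v = indeg v ≤ 1
  IsHybrid v   = 2 ≤ indeg v

  record WellFormed : Set where
    field
      nodesUnique : Unique (nodes N)
      eidsUnique  : Unique (map eid (edges N))
      srcIn       : ∀ {e} → e ∈ edges N → s e ∈ nodes N
      tgtIn       : ∀ {e} → e ∈ edges N → t e ∈ nodes N

  Joins : Edge → ℕ → ℕ → Set
  Joins e u v = (s e ≡ u × t e ≡ v) ⊎ (s e ≡ v × t e ≡ u)

  SDStep : Edge → ℕ → ℕ → Set
  SDStep e u v = (dir e ≡ true × s e ≡ u × t e ≡ v) ⊎ (dir e ≡ false × Joins e u v)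

  data SDPath : ℕ → ℕ → List Edge → List ℕ → Set where
    []  : ∀ {v} → SDPath v v [] []
    cons : ∀ {u w v e es vs} → e ∈ edges N → SDStep e u w →
           SDPath w v es vs → SDPath u v (e ∷ es) (u ∷ vs)

  SDCycle : Set
  SDCycle = Σ ℕ λ v → Σ Edge λ e → Σ (List Edge) λ es → Σ (List ℕ) λ vs →
            SDPath v v (e ∷ es) vs × Unique (map eid (e ∷ es)) × Unique vs

  SDAG : Set
  SDAG = ¬ SDCycle

  UAdj : ℕ → ℕ → Set
  UAdj u v = Any (λ e → dir e ≡ false × Joins e u v) (edges N)

  _∼_ : ℕ → ℕ → Set
  _∼_ = Star UAdj

  Adj : ℕ → ℕ → Set
  Adj u v = Any (λ e → Joins e u v) (edges N)

  Conn : ℕ → ℕ → Set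
  Conn = Star Adj

  -- the ∼-class of v has an incoming directed edge in N/∼
  -- (a directed edge inside the class becomes a loop, hence also incoming)
  ClassHasIncoming : ℕ → Set
  ClassHasIncoming v = Any (λ e → dir e ≡ true × v ∼ t e) (edges N)

  -- the ∼-class of v is a root component (a root of N/∼)
  RootComp : ℕ → Set
  RootComp v = v ∈ nodes N × ¬ ClassHasIncoming v

  TrivialClass : ℕ → Set
  TrivialClass v = ∀ w → w ∈ nodes N → v ∼ w → w ≡ v

  TrivialRootComp : ℕ → Set
  TrivialRootComp v = RootComp v × TrivialClass v

  ResolvedRootComp : ℕ → Set
  ResolvedRootComp v = TrivialRootComp v × (deg v ≡ 0 ⊎ deg v ≡ 2)

  UnresolvedRootComp : ℕ → Set
  UnresolvedRootComp v = RootComp v × ¬ ResolvedRootComp v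

  -- e ∈ adm(T), T the ∼-class of v: edges of T together with all
  -- edges incident to a node of T
  InAdm : ℕ → Edge → Set
  InAdm v e = e ∈ edges N ×
              ((dir e ≡ false × v ∼ s e × v ∼ t e) ⊎ (v ∼ s e ⊎ v ∼ t e))

  record LNetwork : Set where
    field
      wf        : WellFormed
      sdag      : SDAG
      leafTree  : ∀ v → v ∈ nodes N → IsLeaf v → IsTreeNode v
      labelled  : ∀ v → v ∈ nodes N → IsLeaf v → ∃[ x ] lab N v ≡ just x
      labInj    : ∀ v w x → v ∈ nodes N → w ∈ nodes N → IsLeaf v → IsLeaf w →
                  lab N v ≡ just x → lab N w ≡ just x → v ≡ w

  record Complete : Set where
    field
      leafEdges : ∀ v e → v ∈ nodes N → IsLeaf v → e ∈ edges N →
                  (s e ≡ v ⊎ t e ≡ v) → dir e ≡ true × t e ≡ v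
      nontrivClassNoIn : ∀ v w → v ∈ nodes N → w ∈ nodes N → v ∼ w → w ≢ v →
                         ¬ ClassHasIncoming v

  record Binary : Set where
    field
      rootDeg  : ∀ v → v ∈ nodes N → IsRoot v → deg v ≡ 0 ⊎ deg v ≡ 2 ⊎ deg v ≡ 3
      leafDeg  : ∀ v → v ∈ nodes N → IsLeaf v → deg v ≡ 0 ⊎ deg v ≡ 1
      otherDeg : ∀ v → v ∈ nodes N → ¬ IsRoot v → ¬ IsLeaf v → deg v ≡ 3

  AllBase : Set
  AllBase = ∀ e → e ∈ edges N → IsBase (eid e)

  TrivialForest : Set
  TrivialForest = ∀ v → v ∈ nodes N → deg v ≡ 0 × ∃[ x ] lab N v ≡ just x

  NonIsolatedLeaf : ℕ → Set
  NonIsolatedLeaf a = a ∈ nodes N × IsLeaf a × 1 ≤ deg a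

  ParentEdge : ℕ → Edge → Set
  ParentEdge a e = e ∈ edges N × dir e ≡ true × t e ≡ a

  DirEdge : ℕ → ℕ → Edge → Set
  DirEdge p c f = f ∈ edges N × dir f ≡ true × s f ≡ p × t f ≡ c

  Suppressible : ℕ → Set
  Suppressible v = v ∈ nodes N × ¬ IsLeaf v ×
    ((deg v ≡ 2 × ¬ TrivialRootComp v) ⊎
     (deg v ≡ 1 × TrivialRootComp v ×
        Any (λ e → dir e ≡ true × s e ≡ v × IsTreeNode (t e)) (edges N)))

  deleteNode : ℕ → Net n
  deleteNode v = net (filterᵇ (λ w → not (w ≡ᵇ v)) (nodes N))
                     (filterᵇ (λ e → not (incidentᵇ v e)) (edges N))
                     (lab N)

  deleteEdge : Edge → Net n
  deleteEdge f = net (nodes N) (filterᵇ (λ e → not (eid e ==ᴱ eid f)) (edges N)) (lab N)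

  SuppressRel : ℕ → Net n → Set
  SuppressRel v N' =
    -- degree 2: v has exactly the two edges e₁ (to u) and e₂ (to w);
    -- w is chosen as the head of a directed edge v → w if there is one
    (deg v ≡ 2 × Σ Edge λ e₁ → Σ Edge λ e₂ → Σ ℕ λ u → Σ ℕ λ w →
       e₁ ∈ edges N × e₂ ∈ edges N × eid e₁ ≢ eid e₂ ×
       Joins e₁ v u × Joins e₂ v w ×
       (dir e₁ ≡ true → s e₁ ≡ v → dir e₂ ≡ true × s e₂ ≡ v) ×
       N' ≡ net (nodes (deleteNode v))
                (edges (deleteNode v) ++
                   edge (mrg (eid e₁) (eid e₂)) u w (dir e₂ ∧ (s e₂ ≡ᵇ v)) ∷ [])
                (lab N))
    ⊎
    (deg v ≡ 1 × N' ≡ deleteNode v)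

OptSuppress : ∀ {n} → Net n → ℕ → Net n → Set
OptSuppress N v N' = (Suppressible N v × SuppressRel N v N') ⊎ (¬ Suppressible N v × N' ≡ N)

TreeRed : ∀ {n} → Net n → ℕ → ℕ → Net n → Set
TreeRed N a b N' = a ≢ b × NonIsolatedLeaf N a × NonIsolatedLeaf N b ×
  Σ Edge λ ea → Σ Edge λ eb → ParentEdge N a ea × ParentEdge N b eb × s ea ≡ s eb ×
  OptSuppress (deleteNode N a) (s ea) N'

RetRed : ∀ {n} → Net n → ℕ → ℕ → Net n → Set
RetRed N a b N' = a ≢ b × NonIsolatedLeaf N a × NonIsolatedLeaf N b ×
  Σ Edge λ ea → Σ Edge λ eb → ParentEdge N a ea × ParentEdge N b eb ×
  IsHybrid N (s ea) ×
  Σ Edge λ f → DirEdge N (s eb) (s ea) f ×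
  Σ (Net _) λ N₁ → OptSuppress (deleteEdge N f) (s eb) N₁ ×
  SuppressRel N₁ (s ea) N'

Reduce : ∀ {n} → Net n → ℕ × ℕ → Net n → Set
Reduce N (a , b) N' = TreeRed N a b N' ⊎ RetRed N a b N'

data RedSeq {n : ℕ} : Net n → List (ℕ × ℕ) → Net n → Set where
  done : ∀ {N} → RedSeq N [] N
  step : ∀ {N N₁ N₂ c cs} → Reduce N c N₁ → RedSeq N₁ cs N₂ → RedSeq N (c ∷ cs) N₂

Orchard : ∀ {n} → Net n → Set
Orchard N = Σ _ λ S → Σ (Net _) λ M → RedSeq N S M × TrivialForest M

-- some network N^{s₁…s_{i-1}}, i ∈ [k], of the sequence satisfies P
SomeBefore : ∀ {n} {N M : Net n} {S} → (Net n → Set) → RedSeq N S M → Set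
SomeBefore P done = ⊥
SomeBefore {N = N} P (step _ R) = P N ⊎ SomeBefore P R

Parallel : Edge → Edge → Set
Parallel e f = eid e ≢ eid f × ((s e ≡ s f × t e ≡ t f) ⊎ (s e ≡ t f × t e ≡ s f))

ComponentOf : ∀ {n} → Net n → Net n → Set
ComponentOf N K = Σ ℕ λ c → c ∈ nodes K ×
  (∀ w → w ∈ nodes K → w ∈ nodes N × Conn N c w) ×
  (∀ w → w ∈ nodes N → Conn N c w → w ∈ nodes K) ×
  (∀ e → e ∈ edges K → e ∈ edges N × s e ∈ nodes K × t e ∈ nodes K) ×
  (∀ e → e ∈ edges N → s e ∈ nodes K → e ∈ edges K) ×
  (∀ e → e ∈ edges N → t e ∈ nodes K → e ∈ edges K)

IsoUpToLabels : ∀ {n m} → Net n → Net m → Set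
IsoUpToLabels A B =
  Σ (ℕ → ℕ) λ f → Σ (ℕ → ℕ) λ g → Σ (EId → EId) λ φ → Σ (EId → EId) λ ψ →
  (∀ x → x ∈ nodes A → f x ∈ nodes B × g (f x) ≡ x) ×
  (∀ y → y ∈ nodes B → g y ∈ nodes A × f (g y) ≡ y) ×
  (∀ e → e ∈ edges A → ψ (φ (eid e)) ≡ eid e ×
     Any (λ e' → eid e' ≡ φ (eid e) × dir e' ≡ dir e × Match f e e') (edges B)) ×
  (∀ e' → e' ∈ edges B → φ (ψ (eid e')) ≡ eid e' ×
     Any (λ e → eid e ≡ ψ (eid e') × dir e ≡ dir e' × Match f e e') (edges A))
  where
  Match : (ℕ → ℕ) → Edge → Edge → Set
  Match f e e' = (s e' ≡ f (s e) × t e' ≡ f (t e)) ⊎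
                 (dir e ≡ false × s e' ≡ f (t e) × t e' ≡ f (s e))

-- N₂: root u = 0, hybrid v = 1, leaf 1 = node 2, leaf 2 = node 3;
-- edges u → 2, u → v (twice), v → 1
N₂ : Net 2
N₂ = net (0 ∷ 1 ∷ 2 ∷ 3 ∷ [])
         (edge (base 0) 0 3 true ∷ edge (base 1) 0 1 true ∷
          edge (base 2) 0 1 true ∷ edge (base 3) 1 2 true ∷ [])
         labN₂
  where
  labN₂ : ℕ → Maybe (Fin 2)
  labN₂ 2 = just Fin.zero where import Data.Fin as Fin
  labN₂ 3 = just (Fin.suc Fin.zero) where import Data.Fin as Fin
  labN₂ _ = nothing

HasEdge : ∀ {n} → Net n → Edge → Set
HasEdge K h = Any (λ e → eid e ≡ eid h) (edges K)

{-# OPTIONS --safe #-}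

-- Let hi and he be parallel arcs u → v; an SDAG forces them to point the same
-- way. Along a reduction sequence we keep an invariant: both arcs survive,
-- besides them u carries at most one edge and v at most one edge, which leaves
-- v, edge identities stay pairwise incomparable, and leaves have a single
-- in-edge. Every reduction that does not delete an arc only deletes or
-- suppresses nodes other than u and v, and preserves the invariant. A trivial
-- forest has no edge at u, so some reticulate cherry deletes an arc; then the
-- other edges at u and at v lead to the two leaves of the cherry, and these four
-- nodes form a component isomorphic to N₂. For the second claim consider a third
-- edge at u: if it is undirected, the class of u is a nontrivial root component;
-- if it leaves u, then u is a root of degree 3; if it enters u, or there is none,
-- the invariant can demand that the third edge at u keeps entering u, so it never
-- becomes the edge from u to a leaf, and N could not be orchard.

module Submission where

open import Defs
open import Data.Nat using (ℕ; _+_; _≤_; _<_; _≡ᵇ_; z≤n; s≤s)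
open import Data.Nat.Properties using (≡ᵇ⇒≡; ≡⇒≡ᵇ; ≤-trans; ≤-reflexive; m≤m+n; m≤n+m; +-mono-≤; <⇒≱; m<n⇒n≢0; n≢0⇒n>0; _≟_)
open import Data.Bool using (Bool; true; false; _∧_; _∨_; not; T; T?)
open import Data.Bool.Properties using (T-∧; T-∨) renaming (_≟_ to _≟ᴮ_)
open import Function.Bundles using (Equivalence)
open import Data.List using (List; []; _∷_; _++_; length; filterᵇ)
open import Data.List.Properties using (length-++; length-removeAt′)
open import Data.List.Membership.Propositional using (_∈_; _─_; find; lose)
open import Data.List.Membership.Propositional.Properties using (∈-filter⁺; ∈-filter⁻; ∈-++⁺ˡ; ∈-++⁺ʳ; ∈-++⁻)
open import Data.List.Relation.Binary.Subset.Propositional using (_⊆_)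
open import Data.List.Relation.Unary.Any using (here; there; index; any?)
open import Data.List.Relation.Unary.All as All using (All; []; _∷_)
open import Data.List.Relation.Unary.AllPairs as AllPairs using (AllPairs; []; _∷_)
import Data.List.Relation.Unary.AllPairs.Properties as AllPairsₚ
open import Data.List.Relation.Unary.Unique.Propositional using (Unique)
open import Data.Product using (Σ; ∃-syntax; _×_; _,_; proj₁; proj₂; uncurry)
open import Data.Sum using (_⊎_; inj₁; inj₂)
open import Data.Empty using (⊥; ⊥-elim)
open import Data.Unit using (⊤; tt)
open import Function using (_∘_)
open import Relation.Nullary using (¬_; Dec; yes; no; _×-dec_; ¬?)
open import Relation.Binary.PropositionalEquality using (_≡_; _≢_; refl; sym; trans; cong; cong₂; subst; subst₂)
open import Relation.Binary.Construct.Closure.ReflexiveTransitive using (ε; _◅_; _◅◅_)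

module _ {A : Set} where

  ∈-─ : ∀ {x y} {xs : List A} (y∈xs : y ∈ xs) → x ∈ xs → x ≢ y → x ∈ xs ─ y∈xs
  ∈-─ (here refl) (here refl) x≢y = ⊥-elim (x≢y refl)
  ∈-─ (here refl) (there x∈xs) _ = x∈xs
  ∈-─ (there _) (here refl) _ = here refl
  ∈-─ (there y∈xs) (there x∈xs) x≢y = there (∈-─ y∈xs x∈xs x≢y)

  unique-⊆⇒length≤ : ∀ {xs ys : List A} → Unique ys → ys ⊆ xs → length ys ≤ length xs
  unique-⊆⇒length≤ [] _ = z≤n
  unique-⊆⇒length≤ {xs} {y ∷ ys} (y≢ys ∷ ys!) ys⊆xs =
    ≤-trans (s≤s (unique-⊆⇒length≤ ys! ys⊆xs─y)) (≤-reflexive (sym (length-removeAt′ xs (index y∈xs))))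
    where
    y∈xs = ys⊆xs (here refl)
    ys⊆xs─y : ys ⊆ xs ─ y∈xs
    ys⊆xs─y x∈ys = ∈-─ y∈xs (ys⊆xs (there x∈ys)) (λ x≡y → All.lookup y≢ys x∈ys (sym x≡y))

  ∈-filterᵇ⁺ : ∀ (p : A → Bool) {x xs} → x ∈ xs → T (p x) → x ∈ filterᵇ p xs
  ∈-filterᵇ⁺ p = ∈-filter⁺ (T? ∘ p)

  ∈-filterᵇ⁻ : ∀ (p : A → Bool) {x xs} → x ∈ filterᵇ p xs → x ∈ xs × T (p x)
  ∈-filterᵇ⁻ p = ∈-filter⁻ (T? ∘ p)

  unique⇒length≤filter : ∀ (p : A → Bool) {xs ys} → Unique ys → (∀ {y} → y ∈ ys → y ∈ xs × T (p y)) →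
            length ys ≤ length (filterᵇ p xs)
  unique⇒length≤filter p ys! h = unique-⊆⇒length≤ ys! (λ y∈ys → uncurry (∈-filterᵇ⁺ p) (h y∈ys))

  nonempty-filter : ∀ (p : A → Bool) xs → 1 ≤ length (filterᵇ p xs) → ∃[ x ] (x ∈ xs × T (p x))
  nonempty-filter p xs h with filterᵇ p xs in eq
  ... | x ∷ _ = x , ∈-filterᵇ⁻ p (subst (x ∈_) (sym eq) (here refl))

  allPairs-∈ : ∀ {R : A → A → Set} {xs x y} → AllPairs R xs → x ∈ xs → y ∈ xs → x ≢ y → R x y ⊎ R y x
  allPairs-∈ (_ ∷ _) (here refl) (here refl) x≢y = ⊥-elim (x≢y refl)
  allPairs-∈ (r ∷ _) (here refl) (there y∈xs) _ = inj₁ (All.lookup r y∈xs)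
  allPairs-∈ (r ∷ _) (there x∈xs) (here refl) _ = inj₂ (All.lookup r x∈xs)
  allPairs-∈ (_ ∷ rs) (there x∈xs) (there y∈xs) x≢y = allPairs-∈ rs x∈xs y∈xs x≢y

open Equivalence using (to; from)

≡true⇒T : ∀ {b} → b ≡ true → T b
≡true⇒T refl = tt

T⇒≡true : ∀ {b} → T b → b ≡ true
T⇒≡true {true} _ = refl

T-not⇒≡false : ∀ {b} → T (not b) → b ≡ false
T-not⇒≡false {false} _ = refl

T-not⁺ : ∀ {b} → ¬ T b → T (not b)
T-not⁺ {false} _ = tt
T-not⁺ {true} ¬b = ¬b tt

T-not⁻ : ∀ {b} → T (not b) → ¬ T b
T-not⁻ {false} _ ()

T-≡ᵇ⁺ : ∀ {m n} → m ≡ n → T (m ≡ᵇ n)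
T-≡ᵇ⁺ {m} refl = ≡⇒≡ᵇ m m refl

T-≡ᵇ⁻ : ∀ {m n} → T (m ≡ᵇ n) → m ≡ n
T-≡ᵇ⁻ {m} {n} = ≡ᵇ⇒≡ m n

true≢false : true ≢ false
true≢false ()

≡ᵇ-≢ : ∀ {m n} → m ≢ n → (m ≡ᵇ n) ≡ false
≡ᵇ-≢ {m} {n} m≢n with m ≡ᵇ n in eq
... | false = refl
... | true = ⊥-elim (m≢n (T-≡ᵇ⁻ (≡true⇒T eq)))

select : ∀ {P A : Set} → Dec P → A → A → A
select (yes _) x _ = x
select (no _) _ y = y

select-yes : ∀ {P A : Set} (d : Dec P) {x y : A} → P → select d x y ≡ x
select-yes (yes _) _ = refl
select-yes (no ¬p) p = ⊥-elim (¬p p)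

select-no : ∀ {P A : Set} (d : Dec P) {x y : A} → ¬ P → select d x y ≡ y
select-no (yes p) ¬p = ⊥-elim (¬p p)
select-no (no _) _ = refl

infix 4 _⊑_

data _⊑_ : EId → EId → Set where
  ⊑-refl : ∀ {a} → a ⊑ a
  ⊑-mrgˡ : ∀ {a b c} → a ⊑ b → a ⊑ mrg b c
  ⊑-mrgʳ : ∀ {a b c} → a ⊑ c → a ⊑ mrg b c

⊑-trans : ∀ {a b c} → a ⊑ b → b ⊑ c → a ⊑ c
⊑-trans p ⊑-refl = p
⊑-trans p (⊑-mrgˡ q) = ⊑-mrgˡ (⊑-trans p q)
⊑-trans p (⊑-mrgʳ q) = ⊑-mrgʳ (⊑-trans p q)

⊑-base : ∀ {a b} → IsBase b → a ⊑ b → a ≡ b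
⊑-base {b = base _} _ ⊑-refl = refl

eid≟ : (a b : EId) → Dec (a ≡ b)
eid≟ (base m) (base n) with m ≟ n
... | yes refl = yes refl
... | no m≢n = no λ { refl → m≢n refl }
eid≟ (base _) (mrg _ _) = no λ ()
eid≟ (mrg _ _) (base _) = no λ ()
eid≟ (mrg a b) (mrg c d) with eid≟ a c | eid≟ b d
... | yes refl | yes refl = yes refl
... | no a≢c | _ = no λ { refl → a≢c refl }
... | yes _ | no b≢d = no λ { refl → b≢d refl }

==ᴱ⇒≡ : ∀ a b → T (a ==ᴱ b) → a ≡ b
==ᴱ⇒≡ (base m) (base n) eq = cong base (T-≡ᵇ⁻ eq)
==ᴱ⇒≡ (mrg a b) (mrg c d) eq =
  let (a=c , b=d) = to T-∧ eq in cong₂ mrg (==ᴱ⇒≡ a c a=c) (==ᴱ⇒≡ b d b=d)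

==ᴱ-refl : ∀ a → T (a ==ᴱ a)
==ᴱ-refl (base m) = T-≡ᵇ⁺ {m} refl
==ᴱ-refl (mrg a b) = from T-∧ (==ᴱ-refl a , ==ᴱ-refl b)

-- Incomparable rather than merely distinct identities: then the identity
-- mrg a b of a merged edge is fresh, so the property survives suppression.
record Apart (e f : Edge) : Set where
  constructor apart
  field
    left⋢  : ¬ eid e ⊑ eid f
    right⋢ : ¬ eid f ⊑ eid e

IdsApart : List Edge → Set
IdsApart = AllPairs Apart

apart-sym : ∀ {e f} → Apart e f → Apart f e
apart-sym (apart e⋢f f⋢e) = apart f⋢e e⋢f

apart⇒eid≢ : ∀ {e f} → Apart e f → eid e ≢ eid f
apart⇒eid≢ (apart e⋢f _) eq = e⋢f (subst (_ ⊑_) eq ⊑-refl)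

apart-merged : ∀ {x e₁ e₂} → Apart x e₁ → Apart x e₂ →
               ∀ {u w d} → Apart x (edge (mrg (eid e₁) (eid e₂)) u w d)
apart-merged (apart x⋢e₁ e₁⋢x) (apart x⋢e₂ _) = apart x⋢m λ m⊑x → e₁⋢x (⊑-trans (⊑-mrgˡ ⊑-refl) m⊑x)
  where
  x⋢m : ¬ _ ⊑ mrg _ _
  x⋢m ⊑-refl = e₁⋢x (⊑-mrgˡ ⊑-refl)
  x⋢m (⊑-mrgˡ p) = x⋢e₁ p
  x⋢m (⊑-mrgʳ p) = x⋢e₂ p

distinct-base⇒apart : ∀ {e f} → IsBase (eid e) → IsBase (eid f) → eid e ≢ eid f → Apart e f
distinct-base⇒apart be bf e≢f = apart (λ p → e≢f (⊑-base bf p)) (λ p → e≢f (sym (⊑-base be p)))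

distinct-base⇒idsApart : ∀ {es} → All (IsBase ∘ eid) es → AllPairs (λ e f → eid e ≢ eid f) es → IdsApart es
distinct-base⇒idsApart [] [] = []
distinct-base⇒idsApart {e ∷ _} (be ∷ bes) (e≢es ∷ es!) =
  All.zipWith (λ {f} (bf , e≢f) → distinct-base⇒apart {e} {f} be bf e≢f) (bes , e≢es) ∷ distinct-base⇒idsApart bes es!

edge≟ : (e f : Edge) → Dec (e ≡ f)
edge≟ (edge i s₁ t₁ d₁) (edge j s₂ t₂ d₂) with eid≟ i j | s₁ ≟ s₂ | t₁ ≟ t₂ | d₁ ≟ᴮ d₂
... | yes refl | yes refl | yes refl | yes refl = yes refl
... | no i≢j | _ | _ | _ = no λ { refl → i≢j refl }
... | yes _ | no ≢s | _ | _ = no λ { refl → ≢s refl }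
... | yes _ | yes _ | no ≢t | _ = no λ { refl → ≢t refl }
... | yes _ | yes _ | yes _ | no ≢d = no λ { refl → ≢d refl }

module _ {es : List Edge} (es-apart : IdsApart es) where

  idsApart⇒unique : Unique es
  idsApart⇒unique = AllPairs.map (λ ap e≡f → apart⇒eid≢ ap (cong eid e≡f)) es-apart

  idsApart⇒eid-injective : ∀ {e f} → e ∈ es → f ∈ es → eid e ≡ eid f → e ≡ f
  idsApart⇒eid-injective {e} {f} e∈ f∈ eq with edge≟ e f
  ... | yes e≡f = e≡f
  ... | no e≢f with allPairs-∈ es-apart e∈ f∈ e≢f
  ...   | inj₁ ap = ⊥-elim (apart⇒eid≢ ap eq)
  ...   | inj₂ ap = ⊥-elim (apart⇒eid≢ ap (sym eq))

data At (x : ℕ) (e : Edge) : Set where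
  at-s : s e ≡ x → At x e
  at-t : t e ≡ x → At x e

at? : ∀ x e → Dec (At x e)
at? x e with s e ≟ x | t e ≟ x
... | yes s≡x | _ = yes (at-s s≡x)
... | no _ | yes t≡x = yes (at-t t≡x)
... | no s≢x | no t≢x = no λ { (at-s s≡x) → s≢x s≡x ; (at-t t≡x) → t≢x t≡x }

record Into (z : ℕ) (e : Edge) : Set where
  constructor into
  field
    into-dir : dir e ≡ true
    into-t   : t e ≡ z

record OutOf (z : ℕ) (e : Edge) : Set where
  constructor outOf
  field
    out-dir : dir e ≡ true
    out-s   : s e ≡ z

data Exits (z : ℕ) (e : Edge) : Set where
  exits-out   : OutOf z e → Exits z e
  exits-undir : dir e ≡ false → At z e → Exits z e

≢-by-target : ∀ {e e' x y} → t e ≡ x → t e' ≡ y → x ≢ y → e ≢ e'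
≢-by-target t≡x t'≡y x≢y e≡e' = x≢y (trans (sym t≡x) (trans (cong t e≡e') t'≡y))

≢-by-source : ∀ {e e' x y} → s e ≡ x → s e' ≡ y → x ≢ y → e ≢ e'
≢-by-source s≡x s'≡y x≢y e≡e' = x≢y (trans (sym s≡x) (trans (cong s e≡e') s'≡y))

exits-at : ∀ {z e} → Exits z e → At z e
exits-at (exits-out (outOf _ s≡z)) = at-s s≡z
exits-at (exits-undir _ at) = at

-- Joins of Defs without its unused network argument, and as a data type so that
-- the edge and its ends can be inferred.
data Links (e : Edge) (x y : ℕ) : Set where
  forward  : s e ≡ x → t e ≡ y → Links e x y
  backward : s e ≡ y → t e ≡ x → Links e x y

joins⇒links : ∀ {n} (N : Net n) {e x y} → Joins N e x y → Links e x y
joins⇒links _ (inj₁ (s≡x , t≡y)) = forward s≡x t≡y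
joins⇒links _ (inj₂ (s≡y , t≡x)) = backward s≡y t≡x

links-atˡ : ∀ {e x y} → Links e x y → At x e
links-atˡ (forward s≡x _) = at-s s≡x
links-atˡ (backward _ t≡x) = at-t t≡x

links-atʳ : ∀ {e x y} → Links e x y → At y e
links-atʳ (forward _ t≡y) = at-t t≡y
links-atʳ (backward s≡y _) = at-s s≡y

links-other : ∀ {e x y z} → Links e x y → At z e → z ≢ x → z ≡ y
links-other (forward s≡x _) (at-s s≡z) z≢x = ⊥-elim (z≢x (trans (sym s≡z) s≡x))
links-other (forward _ t≡y) (at-t t≡z) _ = trans (sym t≡z) t≡y
links-other (backward s≡y _) (at-s s≡z) _ = trans (sym s≡z) s≡y
links-other (backward _ t≡x) (at-t t≡z) z≢x = ⊥-elim (z≢x (trans (sym t≡z) t≡x))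

merged : Edge → Edge → ℕ → ℕ → ℕ → Edge
merged e₁ e₂ y u w = edge (mrg (eid e₁) (eid e₂)) u w (dir e₂ ∧ (s e₂ ≡ᵇ y))

merged-at : ∀ {e₁ e₂ y u w z} → Links e₁ y u → Links e₂ y w → At z (merged e₁ e₂ y u w) → At z e₁ ⊎ At z e₂
merged-at l₁ _ (at-s refl) = inj₁ (links-atʳ l₁)
merged-at _ l₂ (at-t refl) = inj₂ (links-atʳ l₂)

merged-into : ∀ {e₁ e₂ y u w z} → z ≢ y → Links e₂ y w → Into z (merged e₁ e₂ y u w) → Into z e₂
merged-into {e₂ = e₂} {y} z≢y l₂ (into d refl) with dir e₂ in d₂ | l₂
... | true | forward _ t≡w = into d₂ t≡w
... | true | backward s≡w _ = ⊥-elim (z≢y (trans (sym s≡w) (T-≡ᵇ⁻ (≡true⇒T d))))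

exits-merged : ∀ {e₁ e₂ y u w z} → z ≢ y → Links e₁ y u → Links e₂ y w →
               Exits z e₁ ⊎ Exits z e₂ → Exits z (merged e₁ e₂ y u w)
exits-merged {e₂ = e₂} {y} z≢y l₁ _ (inj₁ x₁) with links-other l₁ (exits-at x₁) z≢y | dir e₂ ∧ (s e₂ ≡ᵇ y)
... | refl | true = exits-out (outOf refl refl)
... | refl | false = exits-undir refl (at-s refl)
exits-merged {e₂ = e₂} {y} z≢y _ l₂ (inj₂ x₂) with links-other l₂ (exits-at x₂) z≢y
... | refl = exits-undir (not-out x₂) (at-t refl)
  where
  not-out : Exits _ e₂ → (dir e₂ ∧ (s e₂ ≡ᵇ y)) ≡ false
  not-out (exits-out (outOf d s≡z)) =
    trans (cong (_∧ (s e₂ ≡ᵇ y)) d) (≡ᵇ-≢ λ s≡y → z≢y (trans (sym s≡z) s≡y))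
  not-out (exits-undir d _) = cong (_∧ (s e₂ ≡ᵇ y)) d

intoᵇ outᵇ undirˢᵇ undirᵗᵇ : ℕ → Edge → Bool
intoᵇ z e = dir e ∧ (t e ≡ᵇ z)
outᵇ z e = dir e ∧ (s e ≡ᵇ z)
undirˢᵇ z e = not (dir e) ∧ (s e ≡ᵇ z)
undirᵗᵇ z e = not (dir e) ∧ (t e ≡ᵇ z)

edge-conn : ∀ {n} {N : Net n} {e} → e ∈ edges N → Conn N (s e) (t e)
edge-conn e∈ = lose e∈ (inj₁ (refl , refl)) ◅ ε

record Other {n} (N : Net n) (x : ℕ) (h₁ h₂ e : Edge) : Set where
  constructor other
  field
    other∈   : e ∈ edges N
    other-at : At x e
    other≢₁  : e ≢ h₁
    other≢₂  : e ≢ h₂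

other? : ∀ {n} {N : Net n} {x h₁ h₂ e} → e ∈ edges N → At x e → e ≡ h₁ ⊎ e ≡ h₂ ⊎ Other N x h₁ h₂ e
other? {h₁ = h₁} {h₂} {e} e∈ at with edge≟ e h₁ | edge≟ e h₂
... | yes e≡h₁ | _ = inj₁ e≡h₁
... | no _ | yes e≡h₂ = inj₂ (inj₁ e≡h₂)
... | no e≢h₁ | no e≢h₂ = inj₂ (inj₂ (other e∈ at e≢h₁ e≢h₂))

record ThirdEdge {n} (N : Net n) (x : ℕ) (h₁ h₂ : Edge) (P : Edge → Set) : Set where
  field
    other-P      : ∀ {e} → Other N x h₁ h₂ e → P e
    other-unique : ∀ {e e'} → Other N x h₁ h₂ e → Other N x h₁ h₂ e' → e ≡ e'

record SuppressOK {n} (N : Net n) (y : ℕ) : Set where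
  field
    out-if-deg1 : deg N y ≡ 1 → ∃[ d ] (d ∈ edges N × OutOf y d)
    single-out  : ∀ {d₁ d₂} → d₁ ∈ edges N → OutOf y d₁ → d₂ ∈ edges N → OutOf y d₂ → d₁ ≡ d₂

module Degrees {n} (N : Net n) where

  private
    E = edges N

  ins outs undirsˢ undirsᵗ incident : ℕ → List Edge
  ins x = filterᵇ (intoᵇ x) E
  outs x = filterᵇ (outᵇ x) E
  undirsˢ x = filterᵇ (undirˢᵇ x) E
  undirsᵗ x = filterᵇ (undirᵗᵇ x) E
  incident x = (ins x ++ outs x) ++ (undirsˢ x ++ undirsᵗ x)

  length-incident : ∀ x → length (incident x) ≡ deg N x
  length-incident x =
    trans (length-++ (ins x ++ outs x)) (cong₂ _+_ (length-++ (ins x)) (length-++ (undirsˢ x)))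

  ∈-incident : ∀ {x e} → e ∈ E → At x e → e ∈ incident x
  ∈-incident {x} {e} e∈ at with dir e in d | at
  ... | true | at-s s≡x = ∈-++⁺ˡ (∈-++⁺ʳ (ins x) (∈-filterᵇ⁺ (outᵇ x) e∈ (from T-∧ (≡true⇒T d , T-≡ᵇ⁺ s≡x))))
  ... | true | at-t t≡x = ∈-++⁺ˡ (∈-++⁺ˡ (∈-filterᵇ⁺ (intoᵇ x) e∈ (from T-∧ (≡true⇒T d , T-≡ᵇ⁺ t≡x))))
  ... | false | at-s s≡x = ∈-++⁺ʳ (ins x ++ outs x) (∈-++⁺ˡ
    (∈-filterᵇ⁺ (undirˢᵇ x) e∈ (from T-∧ (T-not⁺ (λ t → subst T d t) , T-≡ᵇ⁺ s≡x))))
  ... | false | at-t t≡x = ∈-++⁺ʳ (ins x ++ outs x) (∈-++⁺ʳ (undirsˢ x)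
    (∈-filterᵇ⁺ (undirᵗᵇ x) e∈ (from T-∧ (T-not⁺ (λ t → subst T d t) , T-≡ᵇ⁺ t≡x))))

  deg-≥ : ∀ {x es} → Unique es → All (λ e → e ∈ E × At x e) es → length es ≤ deg N x
  deg-≥ {x} es! es-at = subst (_ ≤_) (length-incident x)
    (unique-⊆⇒length≤ es! (λ e∈es → uncurry ∈-incident (All.lookup es-at e∈es)))

  indeg-≥ : ∀ {z es} → Unique es → All (λ e → e ∈ E × Into z e) es → length es ≤ indeg N z
  indeg-≥ {z} es! es-into = unique⇒length≤filter (intoᵇ z) es! λ e∈es →
    let (e∈ , into d t≡z) = All.lookup es-into e∈es in e∈ , from T-∧ (≡true⇒T d , T-≡ᵇ⁺ t≡z)

  outdeg-≥ : ∀ {z es} → Unique es → All (λ e → e ∈ E × OutOf z e) es → length es ≤ outdeg N z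
  outdeg-≥ {z} es! es-out = unique⇒length≤filter (outᵇ z) es! λ e∈es →
    let (e∈ , outOf d s≡z) = All.lookup es-out e∈es in e∈ , from T-∧ (≡true⇒T d , T-≡ᵇ⁺ s≡z)

  udeg-≥1 : ∀ {z e} → e ∈ E → dir e ≡ false → At z e → 1 ≤ udeg N z
  udeg-≥1 {z} {e} e∈ d (at-s s≡z) = ≤-trans (unique⇒length≤filter (undirˢᵇ z) ([] ∷ [])
    λ { (here refl) → e∈ , from T-∧ (T-not⁺ (λ t → subst T d t) , T-≡ᵇ⁺ s≡z) }) (m≤m+n _ _)
  udeg-≥1 {z} {e} e∈ d (at-t t≡z) = ≤-trans (unique⇒length≤filter (undirᵗᵇ z) ([] ∷ [])
    λ { (here refl) → e∈ , from T-∧ (T-not⁺ (λ t → subst T d t) , T-≡ᵇ⁺ t≡z) }) (m≤n+m _ _)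

  in+out≤deg : ∀ z → indeg N z + outdeg N z ≤ deg N z
  in+out≤deg z = m≤m+n _ _

  isLeaf? : ∀ z → Dec (IsLeaf N z)
  isLeaf? z = (outdeg N z ≟ 0) ×-dec (udeg N z ≟ 0)

  exit⇒¬leaf : ∀ {z e} → e ∈ E → Exits z e → ¬ IsLeaf N z
  exit⇒¬leaf e∈ (exits-out out) (out≡0 , _) = m<n⇒n≢0 (outdeg-≥ ([] ∷ []) ((e∈ , out) ∷ [])) out≡0
  exit⇒¬leaf e∈ (exits-undir d at) (_ , u≡0) = m<n⇒n≢0 (udeg-≥1 e∈ d at) u≡0

  ¬leaf⇒exit : ∀ {z} → ¬ IsLeaf N z → ∃[ e ] (e ∈ E × Exits z e)
  ¬leaf⇒exit {z} ¬leaf with outdeg N z ≟ 0 | length (undirsˢ z) ≟ 0 | length (undirsᵗ z) ≟ 0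
  ... | no out≢0 | _ | _ with nonempty-filter (outᵇ z) E (n≢0⇒n>0 out≢0)
  ...   | e , e∈ , p = e , e∈ , exits-out (outOf (T⇒≡true (proj₁ (to T-∧ p))) (T-≡ᵇ⁻ (proj₂ (to T-∧ p))))
  ¬leaf⇒exit {z} ¬leaf | yes _ | no uˢ≢0 | _ with nonempty-filter (undirˢᵇ z) E (n≢0⇒n>0 uˢ≢0)
  ...   | e , e∈ , p = e , e∈ , exits-undir (T-not⇒≡false (proj₁ (to T-∧ p))) (at-s (T-≡ᵇ⁻ (proj₂ (to T-∧ p))))
  ¬leaf⇒exit {z} ¬leaf | yes _ | yes _ | no uᵗ≢0 with nonempty-filter (undirᵗᵇ z) E (n≢0⇒n>0 uᵗ≢0)
  ...   | e , e∈ , p = e , e∈ , exits-undir (T-not⇒≡false (proj₁ (to T-∧ p))) (at-t (T-≡ᵇ⁻ (proj₂ (to T-∧ p))))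
  ¬leaf⇒exit {z} ¬leaf | yes out≡0 | yes uˢ≡0 | yes uᵗ≡0 = ⊥-elim (¬leaf (out≡0 , cong₂ _+_ uˢ≡0 uᵗ≡0))

  into-leaf : ∀ {z e} → IsLeaf N z → e ∈ E → At z e → Into z e
  into-leaf {z} {e} leaf e∈ at with dir e in d | at
  ... | false | _ = ⊥-elim (exit⇒¬leaf e∈ (exits-undir d at) leaf)
  ... | true | at-s s≡z = ⊥-elim (exit⇒¬leaf e∈ (exits-out (outOf d s≡z)) leaf)
  ... | true | at-t t≡z = into d t≡z

  leaf≢source : ∀ {z y e} → IsLeaf N z → e ∈ E → OutOf y e → z ≢ y
  leaf≢source leaf e∈ out refl = exit⇒¬leaf e∈ (exits-out out) leaf

  only-edge : ∀ {x d e} → deg N x ≡ 1 → d ∈ E → At x d → e ∈ E → At x e → e ≡ d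
  only-edge {d = d} {e} deg≡1 d∈ at-d e∈ at-e with edge≟ e d
  ... | yes e≡d = e≡d
  ... | no e≢d = ⊥-elim (<⇒≱ (deg-≥ ((e≢d ∷ []) ∷ [] ∷ []) ((e∈ , at-e) ∷ (d∈ , at-d) ∷ [])) (≤-reflexive deg≡1))

  two-edges : ∀ {x d₁ d₂ e} → deg N x ≤ 2 → d₁ ∈ E → At x d₁ → d₂ ∈ E → At x d₂ → d₁ ≢ d₂ →
              e ∈ E → At x e → e ≡ d₁ ⊎ e ≡ d₂
  two-edges {d₁ = d₁} {d₂} {e} deg≤2 d₁∈ at₁ d₂∈ at₂ d₁≢d₂ e∈ at with edge≟ e d₁ | edge≟ e d₂
  ... | yes e≡d₁ | _ = inj₁ e≡d₁
  ... | no _ | yes e≡d₂ = inj₂ e≡d₂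
  ... | no e≢d₁ | no e≢d₂ = ⊥-elim (<⇒≱ (deg-≥ distinct ((d₁∈ , at₁) ∷ (d₂∈ , at₂) ∷ (e∈ , at) ∷ [])) deg≤2)
    where
    distinct = (d₁≢d₂ ∷ (e≢d₁ ∘ sym) ∷ []) ∷ ((e≢d₂ ∘ sym) ∷ []) ∷ [] ∷ []

  third-edge : ∀ {x h₁ h₂} {P : Edge → Set} → deg N x ≤ 3 → h₁ ∈ E → At x h₁ → h₂ ∈ E → At x h₂ → h₁ ≢ h₂ →
               (∀ {e} → Other N x h₁ h₂ e → P e) → ThirdEdge N x h₁ h₂ P
  third-edge {x} {h₁} {h₂} deg≤3 h₁∈ at₁ h₂∈ at₂ h₁≢h₂ P-other =
    record { other-P = P-other ; other-unique = unique }
    where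
    unique : ∀ {e e'} → Other N x h₁ h₂ e → Other N x h₁ h₂ e' → e ≡ e'
    unique {e} {e'} (other e∈ at e≢h₁ e≢h₂) (other e'∈ at' e'≢h₁ e'≢h₂) with edge≟ e e'
    ... | yes e≡e' = e≡e'
    ... | no e≢e' = ⊥-elim (<⇒≱ (deg-≥ distinct ((h₁∈ , at₁) ∷ (h₂∈ , at₂) ∷ (e∈ , at) ∷ (e'∈ , at') ∷ [])) deg≤3)
      where
      distinct = (h₁≢h₂ ∷ (e≢h₁ ∘ sym) ∷ (e'≢h₁ ∘ sym) ∷ []) ∷ ((e≢h₂ ∘ sym) ∷ (e'≢h₂ ∘ sym) ∷ [])
                 ∷ (e≢e' ∷ []) ∷ [] ∷ []

  class-trivial : ∀ {x w} → (∀ {e} → e ∈ E → At x e → dir e ≡ true) → _∼_ N x w → w ≡ x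
  class-trivial _ ε = refl
  class-trivial directed (adj ◅ _) with find adj
  ... | e , e∈ , d , j = ⊥-elim (true≢false (trans (sym (directed e∈ (links-atˡ (joins⇒links N j)))) d))

  twoOut⇒trivialRoot : ∀ {x d₁ d₂} → x ∈ nodes N → deg N x ≡ 2 →
                       d₁ ∈ E → OutOf x d₁ → d₂ ∈ E → OutOf x d₂ → d₁ ≢ d₂ → TrivialRootComp N x
  twoOut⇒trivialRoot {x} x∈ deg≡2 d₁∈ out₁ d₂∈ out₂ d₁≢d₂ =
    (x∈ , no-incoming) , λ _ _ x∼w → class-trivial directed x∼w
    where
    directed : ∀ {e} → e ∈ E → At x e → dir e ≡ true
    directed e∈ at with two-edges (≤-reflexive deg≡2) d₁∈ (at-s (OutOf.out-s out₁)) d₂∈ (at-s (OutOf.out-s out₂)) d₁≢d₂ e∈ at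
    ... | inj₁ refl = OutOf.out-dir out₁
    ... | inj₂ refl = OutOf.out-dir out₂
    no-incoming : ¬ ClassHasIncoming N x
    no-incoming incoming with find incoming
    ... | e , e∈ , d , x∼t = <⇒≱
      (+-mono-≤ (indeg-≥ ([] ∷ []) ((e∈ , into d (class-trivial directed x∼t)) ∷ []))
                (outdeg-≥ ((d₁≢d₂ ∷ []) ∷ [] ∷ []) ((d₁∈ , out₁) ∷ (d₂∈ , out₂) ∷ [])))
      (≤-trans (in+out≤deg x) (≤-reflexive deg≡2))

  suppressible-deg≤2 : ∀ {y} → Suppressible N y → deg N y ≤ 2
  suppressible-deg≤2 (_ , _ , inj₁ (deg≡2 , _)) = ≤-reflexive deg≡2
  suppressible-deg≤2 (_ , _ , inj₂ (deg≡1 , _)) = ≤-trans (≤-reflexive deg≡1) (s≤s z≤n)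

  single-out-unless-two : ∀ {y} → (∀ {d₁ d₂} → d₁ ∈ E → OutOf y d₁ → d₂ ∈ E → OutOf y d₂ → d₁ ≢ d₂ → ⊥) →
                          ∀ {d₁ d₂} → d₁ ∈ E → OutOf y d₁ → d₂ ∈ E → OutOf y d₂ → d₁ ≡ d₂
  single-out-unless-two no-two {d₁} {d₂} d₁∈ out₁ d₂∈ out₂ with edge≟ d₁ d₂
  ... | yes d₁≡d₂ = d₁≡d₂
  ... | no d₁≢d₂ = ⊥-elim (no-two d₁∈ out₁ d₂∈ out₂ d₁≢d₂)

  suppressible⇒ok : ∀ {y} → Suppressible N y → SuppressOK N y
  suppressible⇒ok (y∈ , _ , inj₁ (deg≡2 , ¬trivial)) = record
    { out-if-deg1 = λ deg≡1 → ⊥-elim (1≢2 (trans (sym deg≡1) deg≡2))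
    ; single-out = single-out-unless-two λ d₁∈ out₁ d₂∈ out₂ d₁≢d₂ →
        ¬trivial (twoOut⇒trivialRoot y∈ deg≡2 d₁∈ out₁ d₂∈ out₂ d₁≢d₂) }
    where
    1≢2 : 1 ≢ 2
    1≢2 ()
  suppressible⇒ok (_ , _ , inj₂ (deg≡1 , _ , child)) = record
    { out-if-deg1 = λ _ → let (d , d∈ , d-dir , d-s , _) = find child in d , d∈ , outOf d-dir d-s
    ; single-out = single-out-unless-two λ d₁∈ out₁ d₂∈ out₂ d₁≢d₂ →
        <⇒≱ (deg-≥ ((d₁≢d₂ ∷ []) ∷ [] ∷ []) ((d₁∈ , at-s (OutOf.out-s out₁)) ∷ (d₂∈ , at-s (OutOf.out-s out₂)) ∷ []))
            (≤-reflexive deg≡1) }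

  through⇒ok : ∀ {y g d} → deg N y ≤ 2 → g ∈ E → Into y g → d ∈ E → OutOf y d → SuppressOK N y
  through⇒ok {y} deg≤2 g∈ in-g d∈ out-d = record
    { out-if-deg1 = λ _ → _ , d∈ , out-d
    ; single-out = single-out-unless-two λ d₁∈ out₁ d₂∈ out₂ d₁≢d₂ → <⇒≱
        (+-mono-≤ (indeg-≥ ([] ∷ []) ((g∈ , in-g) ∷ []))
                  (outdeg-≥ ((d₁≢d₂ ∷ []) ∷ [] ∷ []) ((d₁∈ , out₁) ∷ (d₂∈ , out₂) ∷ [])))
        (≤-trans (in+out≤deg y) deg≤2) }

  binary-deg≤3 : Binary N → ∀ {z} → z ∈ nodes N → ¬ IsLeaf N z → deg N z ≤ 3
  binary-deg≤3 bin {z} z∈ ¬leaf with (indeg N z ≟ 0) ×-dec (udeg N z ≟ 0)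
  ... | no ¬root = ≤-reflexive (Binary.otherDeg bin z z∈ ¬root ¬leaf)
  ... | yes root with Binary.rootDeg bin z z∈ root
  ...   | inj₁ deg≡0 = subst (_≤ 3) (sym deg≡0) z≤n
  ...   | inj₂ (inj₁ deg≡2) = subst (_≤ 3) (sym deg≡2) (s≤s (s≤s z≤n))
  ...   | inj₂ (inj₂ deg≡3) = ≤-reflexive deg≡3

open Degrees public

-- Deleting and suppressing

T-incident⁺ : ∀ {n} (N : Net n) {x e} → At x e → T (incidentᵇ N x e)
T-incident⁺ _ (at-s s≡x) = from T-∨ (inj₁ (T-≡ᵇ⁺ s≡x))
T-incident⁺ _ (at-t t≡x) = from T-∨ (inj₂ (T-≡ᵇ⁺ t≡x))

module _ {n} (N : Net n) where

  deleteNode-edges⁻ : ∀ {x e} → e ∈ edges (deleteNode N x) → e ∈ edges N × ¬ At x e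
  deleteNode-edges⁻ {x} e∈ =
    let (e∈N , p) = ∈-filterᵇ⁻ (λ e → not (incidentᵇ N x e)) e∈ in e∈N , λ at → T-not⁻ p (T-incident⁺ N at)

  deleteNode-edges⁺ : ∀ {x e} → e ∈ edges N → ¬ At x e → e ∈ edges (deleteNode N x)
  deleteNode-edges⁺ {x} {e} e∈ ¬at = ∈-filterᵇ⁺ (λ e → not (incidentᵇ N x e)) e∈ (T-not⁺ (¬at ∘ T-incident⁻))
    where
    T-incident⁻ : T (incidentᵇ N x e) → At x e
    T-incident⁻ p with to T-∨ p
    ... | inj₁ s≡x = at-s (T-≡ᵇ⁻ s≡x)
    ... | inj₂ t≡x = at-t (T-≡ᵇ⁻ t≡x)

  deleteNode-nodes⁻ : ∀ {x z} → z ∈ nodes (deleteNode N x) → z ∈ nodes N × z ≢ x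
  deleteNode-nodes⁻ {x} z∈ =
    let (z∈N , p) = ∈-filterᵇ⁻ (λ w → not (w ≡ᵇ x)) z∈ in z∈N , λ z≡x → T-not⁻ p (T-≡ᵇ⁺ z≡x)

  deleteNode-nodes⁺ : ∀ {x z} → z ∈ nodes N → z ≢ x → z ∈ nodes (deleteNode N x)
  deleteNode-nodes⁺ {x} z∈ z≢x = ∈-filterᵇ⁺ (λ w → not (w ≡ᵇ x)) z∈ (T-not⁺ (z≢x ∘ T-≡ᵇ⁻))

  deleteEdge-edges⁻ : ∀ {f e} → e ∈ edges (deleteEdge N f) → e ∈ edges N × eid e ≢ eid f
  deleteEdge-edges⁻ {f} {e} e∈ =
    let (e∈N , p) = ∈-filterᵇ⁻ (λ e → not (eid e ==ᴱ eid f)) e∈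
    in e∈N , λ eq → T-not⁻ p (subst (λ i → T (i ==ᴱ eid f)) (sym eq) (==ᴱ-refl (eid f)))

  deleteEdge-edges⁺ : ∀ {f e} → e ∈ edges N → eid e ≢ eid f → e ∈ edges (deleteEdge N f)
  deleteEdge-edges⁺ {f} {e} e∈ ids≢ = ∈-filterᵇ⁺ (λ e → not (eid e ==ᴱ eid f)) e∈ (T-not⁺ (ids≢ ∘ ==ᴱ⇒≡ (eid e) (eid f)))

mergeAt : ∀ {n} → Net n → ℕ → Edge → Edge → ℕ → ℕ → Net n
mergeAt N y e₁ e₂ u w = net (nodes (deleteNode N y)) (edges (deleteNode N y) ++ merged e₁ e₂ y u w ∷ []) (lab N)

data Suppression {n} (N : Net n) (y : ℕ) : Net n → Set where
  merge  : ∀ {e₁ e₂ u w} → deg N y ≡ 2 → e₁ ∈ edges N → e₂ ∈ edges N → eid e₁ ≢ eid e₂ →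
           Links e₁ y u → Links e₂ y w → (OutOf y e₁ → OutOf y e₂) → Suppression N y (mergeAt N y e₁ e₂ u w)
  remove : deg N y ≡ 1 → Suppression N y (deleteNode N y)

suppression : ∀ {n} {N N' : Net n} {y} → SuppressRel N y N' → Suppression N y N'
suppression {N = N} (inj₁ (deg≡2 , _ , _ , _ , _ , e₁∈ , e₂∈ , ids≢ , j₁ , j₂ , out-out , refl)) =
  merge deg≡2 e₁∈ e₂∈ ids≢ (joins⇒links N j₁) (joins⇒links N j₂)
        λ (outOf d s≡y) → let (d₂ , s₂≡y) = out-out d s≡y in outOf d₂ s₂≡y
suppression (inj₂ (deg≡1 , refl)) = remove deg≡1

module MergeAt {n} (N : Net n) (y : ℕ) (e₁ e₂ : Edge) (u w : ℕ) where

  mergeAt-edges⁻ : ∀ {e} → e ∈ edges (mergeAt N y e₁ e₂ u w) → (e ∈ edges N × ¬ At y e) ⊎ e ≡ merged e₁ e₂ y u w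
  mergeAt-edges⁻ e∈ with ∈-++⁻ (edges (deleteNode N y)) e∈
  ... | inj₁ e∈old = inj₁ (deleteNode-edges⁻ N e∈old)
  ... | inj₂ (here e≡m) = inj₂ e≡m

  merged∈ : merged e₁ e₂ y u w ∈ edges (mergeAt N y e₁ e₂ u w)
  merged∈ = ∈-++⁺ʳ (edges (deleteNode N y)) (here refl)

module _ {n} {N N' : Net n} {y : ℕ} where

  suppression-nodes⁻ : Suppression N y N' → ∀ {z} → z ∈ nodes N' → z ∈ nodes N × z ≢ y
  suppression-nodes⁻ (merge _ _ _ _ _ _ _) = deleteNode-nodes⁻ N {y}
  suppression-nodes⁻ (remove _) = deleteNode-nodes⁻ N {y}

  suppression-nodes⁺ : Suppression N y N' → ∀ {z} → z ∈ nodes N → z ≢ y → z ∈ nodes N'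
  suppression-nodes⁺ (merge _ _ _ _ _ _ _) = deleteNode-nodes⁺ N {y}
  suppression-nodes⁺ (remove _) = deleteNode-nodes⁺ N {y}

  suppression-edges⁺ : Suppression N y N' → ∀ {e} → e ∈ edges N → ¬ At y e → e ∈ edges N'
  suppression-edges⁺ (merge _ _ _ _ _ _ _) e∈ ¬at = ∈-++⁺ˡ (deleteNode-edges⁺ N {y} e∈ ¬at)
  suppression-edges⁺ (remove _) = deleteNode-edges⁺ N {y}

  suppression-deg≤2 : Suppression N y N' → deg N y ≤ 2
  suppression-deg≤2 (merge deg≡2 _ _ _ _ _ _) = ≤-reflexive deg≡2
  suppression-deg≤2 (remove deg≡1) = ≤-trans (≤-reflexive deg≡1) (s≤s z≤n)

idsApart-filter : ∀ (p : Edge → Bool) {es} → IdsApart es → IdsApart (filterᵇ p es)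
idsApart-filter p = AllPairsₚ.filter⁺ (T? ∘ p)

idsApart-suppression : ∀ {n} {N N' : Net n} {y} → IdsApart (edges N) → Suppression N y N' → IdsApart (edges N')
idsApart-suppression {N = N} {y = y} ap (merge _ e₁∈ e₂∈ _ l₁ l₂ _) =
  AllPairsₚ.++⁺ (idsApart-filter _ ap) ([] ∷ [])
    (All.tabulate λ x∈ → apart-merged (apart-from x∈ e₁∈ (links-atˡ l₁)) (apart-from x∈ e₂∈ (links-atˡ l₂)) ∷ [])
  where
  apart-from : ∀ {x e} → x ∈ edges (deleteNode N y) → e ∈ edges N → At y e → Apart x e
  apart-from x∈ e∈ at with deleteNode-edges⁻ N {y} x∈
  ... | x∈N , ¬at with allPairs-∈ ap x∈N e∈ (λ { refl → ¬at at })
  ...   | inj₁ x~e = x~e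
  ...   | inj₂ e~x = apart-sym e~x
idsApart-suppression ap (remove _) = idsApart-filter _ ap

TwoInEdges : ∀ {n} → Net n → ℕ → Set
TwoInEdges N z = Σ Edge λ e → Σ Edge λ e' → e ∈ edges N × Into z e × e' ∈ edges N × Into z e' × e ≢ e'

SingleParentLeaves : ∀ {n} → Net n → Set
SingleParentLeaves N = ∀ {z} → z ∈ nodes N → IsLeaf N z → ¬ TwoInEdges N z

T-into : ∀ {z e} → T (intoᵇ z e) → Into z e
T-into p = let (d , t≡z) = to T-∧ p in into (T⇒≡true d) (T-≡ᵇ⁻ t≡z)

hybrid⇒twoIn : ∀ {n} {N : Net n} {z} → Unique (edges N) → IsHybrid N z → TwoInEdges N z
hybrid⇒twoIn {N = N} {z} edges! hybrid =
  two (AllPairsₚ.filter⁺ (T? ∘ intoᵇ z) edges!) hybrid (∈-filterᵇ⁻ (intoᵇ z))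
  where
  two : ∀ {xs} → Unique xs → 2 ≤ length xs → (∀ {e} → e ∈ xs → e ∈ edges N × T (intoᵇ z e)) → TwoInEdges N z
  two {e ∷ e' ∷ _} ((e≢e' ∷ _) ∷ _) _ mem =
    let (e∈ , p) = mem (here refl) ; (e'∈ , p') = mem (there (here refl))
    in e , e' , e∈ , T-into p , e'∈ , T-into p' , e≢e'
  two ([] ∷ _) (s≤s ()) _

record Shrinks {n} (N N' : Net n) : Set where
  field
    nodes⊆  : nodes N' ⊆ nodes N
    leaves⁻ : ∀ {z} → z ∈ nodes N' → IsLeaf N' z → IsLeaf N z
    twoIn⁻  : ∀ {z} → z ∈ nodes N' → TwoInEdges N' z → TwoInEdges N z

singleParentLeaves-shrinks : ∀ {n} {N N' : Net n} → SingleParentLeaves N → Shrinks N N' → SingleParentLeaves N'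
singleParentLeaves-shrinks single sh z∈ leaf two = single (nodes⊆ z∈) (leaves⁻ z∈ leaf) (twoIn⁻ z∈ two)
  where open Shrinks sh

module _ {n} (N N' : Net n) where

  twoIn-⊆ : edges N' ⊆ edges N → ∀ {z} → TwoInEdges N' z → TwoInEdges N z
  twoIn-⊆ ⊆ (e , e' , e∈ , in-e , e'∈ , in-e' , e≢e') = e , e' , ⊆ e∈ , in-e , ⊆ e'∈ , in-e' , e≢e'

  leaf-reflect : ∀ {z} → (∀ {e} → e ∈ edges N → Exits z e → ∃[ e' ] (e' ∈ edges N' × Exits z e')) →
                 IsLeaf N' z → IsLeaf N z
  leaf-reflect {z} exit-transfer leaf' with isLeaf? N z
  ... | yes leaf = leaf
  ... | no ¬leaf with ¬leaf⇒exit N ¬leaf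
  ...   | e , e∈ , exit with exit-transfer e∈ exit
  ...     | e' , e'∈ , exit' = ⊥-elim (exit⇒¬leaf N' e'∈ exit' leaf')

directed-exit-source : ∀ {z e} → dir e ≡ true → Exits z e → s e ≡ z
directed-exit-source _ (exits-out (outOf _ s≡z)) = s≡z
directed-exit-source d (exits-undir d' _) = ⊥-elim (true≢false (trans (sym d) d'))

module _ {n} {N : Net n} where

  deleteLeaf-shrinks : ∀ {a ea eb} → (∀ {e} → e ∈ edges N → At a e → e ≡ ea) → dir ea ≡ true →
                       eb ∈ edges N → Exits (s ea) eb → ¬ At a eb → Shrinks N (deleteNode N a)
  deleteLeaf-shrinks {a} {ea} {eb} only-ea ea-dir eb∈ exit-eb ¬at-eb = record
    { nodes⊆ = proj₁ ∘ deleteNode-nodes⁻ N {a}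
    ; leaves⁻ = λ _ → leaf-reflect N (deleteNode N a) transfer
    ; twoIn⁻ = λ _ → twoIn-⊆ N (deleteNode N a) (proj₁ ∘ deleteNode-edges⁻ N {a}) }
    where
    transfer : ∀ {z e} → e ∈ edges N → Exits z e → ∃[ e' ] (e' ∈ edges (deleteNode N a) × Exits z e')
    transfer {e = e} e∈ exit with at? a e
    ... | no ¬at = e , deleteNode-edges⁺ N e∈ ¬at , exit
    ... | yes at with only-ea e∈ at
    ...   | refl = eb , deleteNode-edges⁺ N eb∈ ¬at-eb , subst (λ p → Exits p eb) (directed-exit-source ea-dir exit) exit-eb

  deleteEdge-shrinks : ∀ {f eb} → (∀ {e} → e ∈ edges N → eid e ≡ eid f → e ≡ f) → dir f ≡ true →
                       eb ∈ edges N → Exits (s f) eb → eid eb ≢ eid f → Shrinks N (deleteEdge N f)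
  deleteEdge-shrinks {f} {eb} only-f f-dir eb∈ exit-eb eb≢f = record
    { nodes⊆ = λ z∈ → z∈
    ; leaves⁻ = λ _ → leaf-reflect N (deleteEdge N f) transfer
    ; twoIn⁻ = λ _ → twoIn-⊆ N (deleteEdge N f) (proj₁ ∘ deleteEdge-edges⁻ N {f}) }
    where
    transfer : ∀ {z e} → e ∈ edges N → Exits z e → ∃[ e' ] (e' ∈ edges (deleteEdge N f) × Exits z e')
    transfer {e = e} e∈ exit with eid≟ (eid e) (eid f)
    ... | no e≢f = e , deleteEdge-edges⁺ N {f} e∈ e≢f , exit
    ... | yes e≡f with only-f e∈ e≡f
    ...   | refl = eb , deleteEdge-edges⁺ N {f} eb∈ eb≢f , subst (λ p → Exits p eb) (directed-exit-source f-dir exit) exit-eb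

  exit-suppression : ∀ {y z e} {N' : Net n} → Suppression N y N' → (deg N y ≡ 1 → ∃[ d ] (d ∈ edges N × OutOf y d)) →
                     z ≢ y → e ∈ edges N → Exits z e → ∃[ e' ] (e' ∈ edges N' × Exits z e')
  exit-suppression {y} {e = e} sup _ z≢y e∈ exit with at? y e
  ... | no ¬at = e , suppression-edges⁺ sup e∈ ¬at , exit
  exit-suppression {y} {z} (merge {e₁} {e₂} {u} {w} deg≡2 e₁∈ e₂∈ ids≢ l₁ l₂ _) _ z≢y e∈ exit | yes at =
    merged e₁ e₂ y u w , MergeAt.merged∈ N y e₁ e₂ u w , exits-merged z≢y l₁ l₂ (via-ends (two-edges N (≤-reflexive deg≡2)
      e₁∈ (links-atˡ l₁) e₂∈ (links-atˡ l₂) (λ { refl → ids≢ refl }) e∈ at))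
    where
    via-ends : _ ≡ e₁ ⊎ _ ≡ e₂ → Exits z e₁ ⊎ Exits z e₂
    via-ends (inj₁ refl) = inj₁ exit
    via-ends (inj₂ refl) = inj₂ exit
  exit-suppression (remove deg≡1) out-if-deg1 z≢y e∈ exit | yes at with out-if-deg1 deg≡1
  ... | d , d∈ , outOf d-dir d-s with only-edge N deg≡1 d∈ (at-s d-s) e∈ at
  ...   | refl = ⊥-elim (z≢y (trans (sym (directed-exit-source d-dir exit)) d-s))

  suppression-shrinks : ∀ {y} {N' : Net n} → Suppression N y N' → (deg N y ≡ 1 → ∃[ d ] (d ∈ edges N × OutOf y d)) →
                        Shrinks N N'
  suppression-shrinks {y} {N'} sup out-if-deg1 = record
    { nodes⊆ = proj₁ ∘ suppression-nodes⁻ sup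
    ; leaves⁻ = λ z∈ → leaf-reflect N N' (exit-suppression sup out-if-deg1 (proj₂ (suppression-nodes⁻ sup z∈)))
    ; twoIn⁻ = λ z∈ → twoIn (proj₂ (suppression-nodes⁻ sup z∈)) sup }
    where
    twoIn : ∀ {z N''} → z ≢ y → Suppression N y N'' → TwoInEdges N'' z → TwoInEdges N z
    twoIn z≢y (remove _) = twoIn-⊆ N (deleteNode N y) (proj₁ ∘ deleteNode-edges⁻ N {y})
    twoIn z≢y (merge {e₁} {e₂} {u} {w} _ _ e₂∈ _ _ l₂ _) (e , e' , e∈ , in-e , e'∈ , in-e' , e≢e')
      with MergeAt.mergeAt-edges⁻ N y e₁ e₂ u w e∈ | MergeAt.mergeAt-edges⁻ N y e₁ e₂ u w e'∈
    ... | inj₁ (e∈N , _) | inj₁ (e'∈N , _) = e , e' , e∈N , in-e , e'∈N , in-e' , e≢e'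
    ... | inj₁ (e∈N , ¬at) | inj₂ refl =
      e , e₂ , e∈N , in-e , e₂∈ , merged-into {e₁} z≢y l₂ in-e' , λ { refl → ¬at (links-atˡ l₂) }
    ... | inj₂ refl | inj₁ (e'∈N , ¬at) =
      e₂ , e' , e₂∈ , merged-into {e₁} z≢y l₂ in-e , e'∈N , in-e' , λ { refl → ¬at (links-atˡ l₂) }
    ... | inj₂ refl | inj₂ refl = ⊥-elim (e≢e' refl)

MergeStable : (Edge → Set) → ℕ → Set
MergeStable P x = ∀ {y e₁ e₂ u w} → y ≢ x → Links e₁ y u → Links e₂ y w → ¬ OutOf y e₁ →
                  (P e₁ × At x e₁ × ¬ At x e₂) ⊎ (P e₂ × At x e₂ × ¬ At x e₁) → P (merged e₁ e₂ y u w)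

exits-stable : ∀ {x} → MergeStable (Exits x) x
exits-stable y≢x l₁ l₂ _ (inj₁ (exit₁ , _)) = exits-merged (y≢x ∘ sym) l₁ l₂ (inj₁ exit₁)
exits-stable y≢x l₁ l₂ _ (inj₂ (exit₂ , _)) = exits-merged (y≢x ∘ sym) l₁ l₂ (inj₂ exit₂)

module _ {n} {N : Net n} {x : ℕ} {h₁ h₂ : Edge} {P : Edge → Set} where

  relocate : ∀ {N' : Net n} {e} → Other N' x h₁ h₂ e → e ∈ edges N → Other N x h₁ h₂ e
  relocate (other _ at ≢₁ ≢₂) e∈ = other e∈ at ≢₁ ≢₂

  thirdEdge-⊆ : ∀ {N' : Net n} → ThirdEdge N x h₁ h₂ P → edges N' ⊆ edges N → ThirdEdge N' x h₁ h₂ P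
  thirdEdge-⊆ third ⊆ = record
    { other-P = λ o → other-P (relocate o (⊆ (Other.other∈ o)))
    ; other-unique = λ o o' → other-unique (relocate o (⊆ (Other.other∈ o))) (relocate o' (⊆ (Other.other∈ o'))) }
    where open ThirdEdge third

  thirdEdge-suppression : ∀ {y} {N' : Net n} → ThirdEdge N x h₁ h₂ P → MergeStable P x → Suppression N y N' →
                          SuppressOK N y → y ≢ x → ¬ At y h₁ → ¬ At y h₂ → ThirdEdge N' x h₁ h₂ P
  thirdEdge-suppression {y} third _ (remove _) _ _ _ _ = thirdEdge-⊆ third (proj₁ ∘ deleteNode-edges⁻ N {y})
  thirdEdge-suppression {y} third stable (merge {e₁} {e₂} {u} {w} _ e₁∈ e₂∈ ids≢ l₁ l₂ out⇒out) ok y≢x ¬h₁ ¬h₂ =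
    record { other-P = other-P′ ; other-unique = other-unique′ }
    where
    open ThirdEdge third
    open MergeAt N y e₁ e₂ u w
    m : Edge
    m = merged e₁ e₂ y u w

    e₁≢e₂ : e₁ ≢ e₂
    e₁≢e₂ e₁≡e₂ = ids≢ (cong eid e₁≡e₂)

    ¬out₁ : ¬ OutOf y e₁
    ¬out₁ out₁ = e₁≢e₂ (SuppressOK.single-out ok e₁∈ out₁ e₂∈ (out⇒out out₁))

    through-y : ∀ {e} → e ∈ edges N → At y e → At x e → Other N x h₁ h₂ e
    through-y e∈ at-y at-x = other e∈ at-x (λ { refl → ¬h₁ at-y }) (λ { refl → ¬h₂ at-y })

    other₁ : At x e₁ → Other N x h₁ h₂ e₁
    other₁ = through-y e₁∈ (links-atˡ l₁)

    other₂ : At x e₂ → Other N x h₁ h₂ e₂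
    other₂ = through-y e₂∈ (links-atˡ l₂)

    P-merged : At x m → P m
    P-merged at = stable y≢x l₁ l₂ ¬out₁ (side (merged-at l₁ l₂ at))
      where
      side : At x e₁ ⊎ At x e₂ → (P e₁ × At x e₁ × ¬ At x e₂) ⊎ (P e₂ × At x e₂ × ¬ At x e₁)
      side (inj₁ at₁) = inj₁ (other-P (other₁ at₁) , at₁ , λ at₂ → e₁≢e₂ (other-unique (other₁ at₁) (other₂ at₂)))
      side (inj₂ at₂) = inj₂ (other-P (other₂ at₂) , at₂ , λ at₁ → e₁≢e₂ (other-unique (other₁ at₁) (other₂ at₂)))

    -- the merged edge at x took the place of the unique other edge at x
    stale : ∀ {e} → Other N x h₁ h₂ e → ¬ At y e → At x m → ⊥
    stale o ¬at-y at with merged-at l₁ l₂ at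
    ... | inj₁ at₁ = ¬at-y (subst (At y) (sym (other-unique o (other₁ at₁))) (links-atˡ l₁))
    ... | inj₂ at₂ = ¬at-y (subst (At y) (sym (other-unique o (other₂ at₂))) (links-atˡ l₂))

    other-P′ : ∀ {e} → Other (mergeAt N y e₁ e₂ u w) x h₁ h₂ e → P e
    other-P′ o with mergeAt-edges⁻ (Other.other∈ o)
    ... | inj₁ (e∈ , _) = other-P (relocate o e∈)
    ... | inj₂ refl = P-merged (Other.other-at o)

    other-unique′ : ∀ {e e'} → Other (mergeAt N y e₁ e₂ u w) x h₁ h₂ e → Other (mergeAt N y e₁ e₂ u w) x h₁ h₂ e' → e ≡ e'
    other-unique′ o o' with mergeAt-edges⁻ (Other.other∈ o) | mergeAt-edges⁻ (Other.other∈ o')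
    ... | inj₁ (e∈ , _) | inj₁ (e'∈ , _) = other-unique (relocate o e∈) (relocate o' e'∈)
    ... | inj₁ (e∈ , ¬at) | inj₂ refl = ⊥-elim (stale (relocate o e∈) ¬at (Other.other-at o'))
    ... | inj₂ refl | inj₁ (e'∈ , ¬at) = ⊥-elim (stale (relocate o' e'∈) ¬at (Other.other-at o))
    ... | inj₂ refl | inj₂ refl = refl

-- Two parallel arcs along a reduction sequence

record ParallelArcs (hi he : Edge) : Set where
  field
    hi-dir : dir hi ≡ true
    he-dir : dir he ≡ true
    same-s : s he ≡ s hi
    same-t : t he ≡ t hi
    s≢t    : s hi ≢ t hi
    hi≢he  : hi ≢ he

module Tracking {n : ℕ} {hi he : Edge} (arcs : ParallelArcs hi he)
                (Q : Edge → Set) (Q-stable : MergeStable Q (s hi)) where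

  open ParallelArcs arcs

  u v : ℕ
  u = s hi
  v = t hi

  hi-into : Into v hi
  hi-into = into hi-dir refl

  he-into : Into v he
  he-into = into he-dir same-t

  not-arcˢ : ∀ {e} → s e ≢ u → e ≢ hi × e ≢ he
  not-arcˢ s≢u = (λ { refl → s≢u refl }) , (λ { refl → s≢u same-s })

  not-arcᵗ : ∀ {e} → t e ≢ v → e ≢ hi × e ≢ he
  not-arcᵗ t≢v = (λ { refl → t≢v refl }) , (λ { refl → t≢v same-t })

  not-arc-by-id : ∀ {e} → eid e ≢ eid hi → eid e ≢ eid he → e ≢ hi × e ≢ he
  not-arc-by-id ≢hi ≢he = (λ { refl → ≢hi refl }) , (λ { refl → ≢he refl })

  off-arcs : ∀ {x} → x ≢ u → x ≢ v → ¬ At x hi × ¬ At x he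
  off-arcs x≢u x≢v =
    (λ { (at-s refl) → x≢u refl ; (at-t refl) → x≢v refl }) ,
    (λ { (at-s s≡x) → x≢u (trans (sym s≡x) same-s) ; (at-t t≡x) → x≢v (trans (sym t≡x) same-t) })

  record Invariant (N : Net n) : Set where
    field
      ids-apart     : IdsApart (edges N)
      single-parent : SingleParentLeaves N
      hi∈           : hi ∈ edges N
      he∈           : he ∈ edges N
      u∈            : u ∈ nodes N
      v∈            : v ∈ nodes N
      third-u       : ThirdEdge N u hi he Q
      third-v       : ThirdEdge N v hi he (Exits v)

  module _ {N : Net n} (inv : Invariant N) where

    open Invariant inv

    u-¬leaf : ¬ IsLeaf N u
    u-¬leaf = exit⇒¬leaf N hi∈ (exits-out (outOf hi-dir refl))

    v-¬leaf : ¬ IsLeaf N v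
    v-¬leaf leaf = single-parent v∈ leaf (hi , he , hi∈ , hi-into , he∈ , he-into , hi≢he)

    leaf≢u : ∀ {a} → IsLeaf N a → a ≢ u
    leaf≢u leaf refl = u-¬leaf leaf

    leaf≢v : ∀ {a} → IsLeaf N a → a ≢ v
    leaf≢v leaf refl = v-¬leaf leaf

    eid-injective : ∀ {e f} → e ∈ edges N → f ∈ edges N → eid e ≡ eid f → e ≡ f
    eid-injective = idsApart⇒eid-injective ids-apart

    only-parent : ∀ {a ea e} → a ∈ nodes N → IsLeaf N a → ea ∈ edges N → Into a ea → e ∈ edges N → At a e → e ≡ ea
    only-parent {ea = ea} {e} a∈ leaf ea∈ ea-in e∈ at with edge≟ e ea
    ... | yes e≡ea = e≡ea
    ... | no e≢ea = ⊥-elim (single-parent a∈ leaf (e , _ , e∈ , into-leaf N leaf e∈ at , ea∈ , ea-in , e≢ea))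

    into-leaf-off-arcs : ∀ {c e} → IsLeaf N c → t e ≡ c → e ≢ hi × e ≢ he
    into-leaf-off-arcs leaf t≡c = not-arcᵗ λ t≡v → leaf≢v leaf (trans (sym t≡c) t≡v)

    into-u-unique : ∀ {e e'} → e ∈ edges N → Into u e → e' ∈ edges N → Into u e' → e ≡ e'
    into-u-unique e∈ (into _ t≡u) e'∈ (into _ t'≡u) = ThirdEdge.other-unique third-u (into-u e∈ t≡u) (into-u e'∈ t'≡u)
      where
      into-u : ∀ {e} → e ∈ edges N → t e ≡ u → Other N u hi he e
      into-u e∈ t≡u = let (≢hi , ≢he) = not-arcᵗ λ t≡v → s≢t (trans (sym t≡u) t≡v) in other e∈ (at-t t≡u) ≢hi ≢he

    invariant-deleteLeaf : ∀ {a ea eb} → a ∈ nodes N → IsLeaf N a → ea ∈ edges N → Into a ea →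
                           eb ∈ edges N → Exits (s ea) eb → ¬ At a eb → Invariant (deleteNode N a)
    invariant-deleteLeaf {a} a∈ leaf ea∈ ea-in eb∈ eb-exit ¬at = record
      { ids-apart = idsApart-filter (λ e → not (incidentᵇ N a e)) ids-apart
      ; single-parent = singleParentLeaves-shrinks single-parent
          (deleteLeaf-shrinks {N = N} (only-parent a∈ leaf ea∈ ea-in) (Into.into-dir ea-in) eb∈ eb-exit ¬at)
      ; hi∈ = deleteNode-edges⁺ N hi∈ (proj₁ off)
      ; he∈ = deleteNode-edges⁺ N he∈ (proj₂ off)
      ; u∈ = deleteNode-nodes⁺ N u∈ (leaf≢u leaf ∘ sym)
      ; v∈ = deleteNode-nodes⁺ N v∈ (leaf≢v leaf ∘ sym)
      ; third-u = thirdEdge-⊆ third-u (proj₁ ∘ deleteNode-edges⁻ N {a})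
      ; third-v = thirdEdge-⊆ third-v (proj₁ ∘ deleteNode-edges⁻ N {a}) }
      where
      off = off-arcs (leaf≢u leaf) (leaf≢v leaf)

    invariant-deleteEdge : ∀ {f eb} → f ∈ edges N → dir f ≡ true → eid f ≢ eid hi → eid f ≢ eid he →
                           eb ∈ edges N → Exits (s f) eb → eid eb ≢ eid f → Invariant (deleteEdge N f)
    invariant-deleteEdge {f} f∈ f-dir f≢hi f≢he eb∈ eb-exit eb≢f = record
      { ids-apart = idsApart-filter (λ e → not (eid e ==ᴱ eid f)) ids-apart
      ; single-parent = singleParentLeaves-shrinks single-parent
          (deleteEdge-shrinks {N = N} (λ e∈ → eid-injective e∈ f∈) f-dir eb∈ eb-exit eb≢f)
      ; hi∈ = deleteEdge-edges⁺ N {f} hi∈ (f≢hi ∘ sym)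
      ; he∈ = deleteEdge-edges⁺ N {f} he∈ (f≢he ∘ sym)
      ; u∈ = u∈
      ; v∈ = v∈
      ; third-u = thirdEdge-⊆ third-u (proj₁ ∘ deleteEdge-edges⁻ N {f})
      ; third-v = thirdEdge-⊆ third-v (proj₁ ∘ deleteEdge-edges⁻ N {f}) }

    invariant-suppression : ∀ {y N'} → Suppression N y N' → SuppressOK N y → y ≢ u → y ≢ v → Invariant N'
    invariant-suppression sup ok y≢u y≢v = record
      { ids-apart = idsApart-suppression ids-apart sup
      ; single-parent = singleParentLeaves-shrinks single-parent (suppression-shrinks sup (SuppressOK.out-if-deg1 ok))
      ; hi∈ = suppression-edges⁺ sup hi∈ (proj₁ off)
      ; he∈ = suppression-edges⁺ sup he∈ (proj₂ off)
      ; u∈ = suppression-nodes⁺ sup u∈ (y≢u ∘ sym)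
      ; v∈ = suppression-nodes⁺ sup v∈ (y≢v ∘ sym)
      ; third-u = thirdEdge-suppression third-u Q-stable sup ok y≢u (proj₁ off) (proj₂ off)
      ; third-v = thirdEdge-suppression third-v exits-stable sup ok y≢v (proj₁ off) (proj₂ off) }
      where
      off = off-arcs y≢u y≢v

  initial : ∀ {N} → LNetwork N → Binary N → AllBase N → hi ∈ edges N → he ∈ edges N →
            ThirdEdge N u hi he Q → Invariant N
  initial {N} lnet bin all-base hi∈ he∈ third-u = record
    { ids-apart = distinct-base⇒idsApart (All.tabulate λ {e} e∈ → all-base e e∈) (AllPairsₚ.map⁻ (WellFormed.eidsUnique wf))
    ; single-parent = λ z∈ leaf (_ , _ , e∈ , in-e , e'∈ , in-e' , e≢e') →
        <⇒≱ (indeg-≥ N ((e≢e' ∷ []) ∷ [] ∷ []) ((e∈ , in-e) ∷ (e'∈ , in-e') ∷ [])) (LNetwork.leafTree lnet _ z∈ leaf)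
    ; hi∈ = hi∈
    ; he∈ = he∈
    ; u∈ = WellFormed.srcIn wf hi∈
    ; v∈ = v∈
    ; third-u = third-u
    ; third-v = third-edge N deg≤3 hi∈ (at-t refl) he∈ (at-t same-t) hi≢he exits-v }
    where
    wf : WellFormed N
    wf = LNetwork.wf lnet

    v∈ : v ∈ nodes N
    v∈ = WellFormed.tgtIn wf hi∈

    v-¬leaf₀ : ¬ IsLeaf N v
    v-¬leaf₀ leaf = <⇒≱ (indeg-≥ N ((hi≢he ∷ []) ∷ [] ∷ []) ((hi∈ , hi-into) ∷ (he∈ , he-into) ∷ []))
                       (LNetwork.leafTree lnet v v∈ leaf)

    deg≤3 : deg N v ≤ 3
    deg≤3 = binary-deg≤3 N bin v∈ v-¬leaf₀

    arcs-enter-v : ∀ {e} → e ≡ hi ⊎ e ≡ he → ¬ Exits v e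
    arcs-enter-v (inj₁ refl) (exits-out (outOf _ s≡v)) = s≢t s≡v
    arcs-enter-v (inj₁ refl) (exits-undir d _) = true≢false (trans (sym hi-dir) d)
    arcs-enter-v (inj₂ refl) (exits-out (outOf _ s≡v)) = s≢t (trans (sym same-s) s≡v)
    arcs-enter-v (inj₂ refl) (exits-undir d _) = true≢false (trans (sym he-dir) d)

    exits-v : ∀ {e} → Other N v hi he e → Exits v e
    exits-v o with ¬leaf⇒exit N v-¬leaf₀
    ... | x , x∈ , exit-x = subst (Exits v) (other-unique x-other o) exit-x
      where
      open ThirdEdge (third-edge N deg≤3 hi∈ (at-t refl) he∈ (at-t same-t) hi≢he (λ _ → tt))
      x-other = other x∈ (exits-at exit-x) (λ x≡hi → arcs-enter-v (inj₁ x≡hi) exit-x)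
                                           (λ x≡he → arcs-enter-v (inj₂ x≡he) exit-x)

  -- A reticulate cherry (a, b) deleting one of the arcs, seen just before the reduction.
  record Critical (N : Net n) : Set where
    constructor critical
    field
      {a b}   : ℕ
      {ea eb} : Edge
      ea∈    : ea ∈ edges N
      ea-out : OutOf v ea
      ea-in  : Into a ea
      eb∈    : eb ∈ edges N
      eb-out : OutOf u eb
      eb-in  : Into b eb
      a∈     : a ∈ nodes N
      b∈     : b ∈ nodes N
      a-leaf : IsLeaf N a
      b-leaf : IsLeaf N b
      a≢b    : a ≢ b

  step-tree : ∀ {N N' a b} → Invariant N → TreeRed N a b N' → Invariant N'
  step-tree {N} {N'} {a} {b} inv (a≢b , (a∈ , a-leaf , _) , (_ , b-leaf , _) , ea , eb ,
                                 (ea∈ , ea-dir , ea-t) , (eb∈ , eb-dir , eb-t) , same-parent , opt) = finish opt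
    where
    open Invariant inv

    N₁ : Net n
    N₁ = deleteNode N a

    ¬a-eb : ¬ At a eb
    ¬a-eb (at-s s≡a) = leaf≢source N a-leaf eb∈ (outOf eb-dir refl) (sym s≡a)
    ¬a-eb (at-t t≡a) = a≢b (trans (sym t≡a) eb-t)

    inv₁ : Invariant N₁
    inv₁ = invariant-deleteLeaf inv a∈ a-leaf ea∈ (into ea-dir ea-t) eb∈ (exits-out (outOf eb-dir (sym same-parent))) ¬a-eb

    p≢u : s ea ≢ u
    p≢u p≡u = ≢-by-target ea-t eb-t a≢b ea≡eb
      where
      child-of-u : ∀ {e c} → e ∈ edges N → s e ≡ u → t e ≡ c → IsLeaf N c → Other N u hi he e
      child-of-u e∈ s≡u t≡c leaf = let (≢hi , ≢he) = into-leaf-off-arcs inv leaf t≡c in other e∈ (at-s s≡u) ≢hi ≢he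
      ea≡eb = ThirdEdge.other-unique third-u (child-of-u ea∈ p≡u ea-t a-leaf)
                (child-of-u eb∈ (trans (sym same-parent) p≡u) eb-t b-leaf)

    p≢v : Suppressible N₁ (s ea) → s ea ≢ v
    p≢v sup p≡v = <⇒≱ (deg-≥ N₁ distinct ((Invariant.hi∈ inv₁ , at-t refl) ∷ (Invariant.he∈ inv₁ , at-t same-t) ∷
                                          (eb∈₁ , at-s eb-s) ∷ []))
                      (subst (λ x → deg N₁ x ≤ 2) p≡v (suppressible-deg≤2 N₁ sup))
      where
      eb-s = trans (sym same-parent) p≡v
      eb∈₁ = deleteNode-edges⁺ N eb∈ ¬a-eb
      eb-off = not-arcˢ λ s≡u → s≢t (trans (sym s≡u) eb-s)
      distinct = (hi≢he ∷ (proj₁ eb-off ∘ sym) ∷ []) ∷ ((proj₂ eb-off ∘ sym) ∷ []) ∷ [] ∷ []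

    finish : OptSuppress N₁ (s ea) N' → Invariant N'
    finish (inj₂ (_ , refl)) = inv₁
    finish (inj₁ (sup , sr)) = invariant-suppression inv₁ (suppression sr) (suppressible⇒ok N₁ sup) p≢u (p≢v sup)

  module RetStep {N : Net n} {a b : ℕ} {ea eb f : Edge} (inv : Invariant N)
                 (a≢b : a ≢ b) (a-leaf : IsLeaf N a) (b-leaf : IsLeaf N b)
                 (ea∈ : ea ∈ edges N) (ea-in : Into a ea) (eb∈ : eb ∈ edges N) (eb-in : Into b eb)
                 (hybrid : IsHybrid N (s ea)) (f∈ : f ∈ edges N) (f-out : OutOf (s eb) f) (f-in : Into (s ea) f)
                 (f≢hi : eid f ≢ eid hi) (f≢he : eid f ≢ eid he) where

    open Invariant inv

    pa pb : ℕ
    pa = s ea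
    pb = s eb

    N₀ : Net n
    N₀ = deleteEdge N f

    ea-out : OutOf pa ea
    ea-out = outOf (Into.into-dir ea-in) refl

    eb-out : OutOf pb eb
    eb-out = outOf (Into.into-dir eb-in) refl

    a≢pa : a ≢ pa
    a≢pa = leaf≢source N a-leaf ea∈ ea-out

    b≢pa : b ≢ pa
    b≢pa = leaf≢source N b-leaf ea∈ ea-out

    a≢pb : a ≢ pb
    a≢pb = leaf≢source N a-leaf eb∈ eb-out

    not-f : ∀ {c e} → e ∈ edges N → t e ≡ c → c ≢ pa → eid e ≢ eid f
    not-f e∈ t≡c c≢pa eq = c≢pa (trans (sym t≡c) (trans (cong t (eid-injective inv e∈ f∈ eq)) (Into.into-t f-in)))

    ea≢f : eid ea ≢ eid f
    ea≢f = not-f ea∈ (Into.into-t ea-in) a≢pa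

    eb≢f : eid eb ≢ eid f
    eb≢f = not-f eb∈ (Into.into-t eb-in) b≢pa

    f-off : f ≢ hi × f ≢ he
    f-off = not-arc-by-id f≢hi f≢he

    second-parent : Σ Edge λ g → g ∈ edges N × Into pa g × g ≢ f
    second-parent with hybrid⇒twoIn {N = N} (idsApart⇒unique ids-apart) hybrid
    ... | e , e' , e∈ , in-e , e'∈ , in-e' , e≢e' with edge≟ e f
    ...   | yes refl = e' , e'∈ , in-e' , e≢e' ∘ sym
    ...   | no e≢f = e , e∈ , in-e , e≢f

    g : Edge
    g = proj₁ second-parent

    g∈ : g ∈ edges N
    g∈ = proj₁ (proj₂ second-parent)

    g-in : Into pa g
    g-in = proj₁ (proj₂ (proj₂ second-parent))

    g≢f : g ≢ f
    g≢f = proj₂ (proj₂ (proj₂ second-parent))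

    inv₀ : Invariant N₀
    inv₀ = invariant-deleteEdge inv f∈ (OutOf.out-dir f-out) f≢hi f≢he eb∈
             (exits-out (outOf (OutOf.out-dir eb-out) (sym (OutOf.out-s f-out)))) eb≢f

    ea∈₀ : ea ∈ edges N₀
    ea∈₀ = deleteEdge-edges⁺ N {f} ea∈ ea≢f

    eb∈₀ : eb ∈ edges N₀
    eb∈₀ = deleteEdge-edges⁺ N {f} eb∈ eb≢f

    g∈₀ : g ∈ edges N₀
    g∈₀ = deleteEdge-edges⁺ N {f} g∈ (g≢f ∘ eid-injective inv g∈ f∈)

    pb≢u : pb ≢ u
    pb≢u pb≡u = eb≢f (cong eid (ThirdEdge.other-unique third-u
      (other eb∈ (at-s pb≡u) (proj₁ eb-off) (proj₂ eb-off))
      (other f∈ (at-s (trans (OutOf.out-s f-out) pb≡u)) (proj₁ f-off) (proj₂ f-off))))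
      where
      eb-off = into-leaf-off-arcs inv b-leaf (Into.into-t eb-in)

    pa≢u : pa ≢ u
    pa≢u pa≡u = g≢f (into-u-unique inv g∈ (into (Into.into-dir g-in) (trans (Into.into-t g-in) pa≡u))
                                       f∈ (into (Into.into-dir f-in) (trans (Into.into-t f-in) pa≡u)))

    pa≢v : pa ≢ v
    pa≢v pa≡v = ea≢f (cong eid (ThirdEdge.other-unique third-v
      (other ea∈ (at-s pa≡v) (proj₁ ea-off) (proj₂ ea-off))
      (other f∈ (at-t (trans (Into.into-t f-in) pa≡v)) (proj₁ f-off) (proj₂ f-off))))
      where
      ea-off = into-leaf-off-arcs inv a-leaf (Into.into-t ea-in)

    suppress-pa : ∀ {N₁ N'} → Invariant N₁ → ea ∈ edges N₁ → g ∈ edges N₁ → SuppressRel N₁ pa N' → Invariant N'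
    suppress-pa {N₁} inv₁ ea∈₁ g∈₁ sr =
      invariant-suppression inv₁ sup (through⇒ok N₁ (suppression-deg≤2 sup) g∈₁ g-in ea∈₁ ea-out) pa≢u pa≢v
      where
      sup = suppression sr

    module _ (suppressible : Suppressible N₀ pb) where

      ok₀ : SuppressOK N₀ pb
      ok₀ = suppressible⇒ok N₀ suppressible

      deg≤2 : deg N₀ pb ≤ 2
      deg≤2 = suppressible-deg≤2 N₀ suppressible

      pa≢pb : pa ≢ pb
      pa≢pb pa≡pb = <⇒≱ (deg-≥ N₀ distinct ((ea∈₀ , at-s pa≡pb) ∷ (eb∈₀ , at-s refl) ∷ (g∈₀ , at-t g-t) ∷ [])) deg≤2
        where
        g-t = trans (Into.into-t g-in) pa≡pb
        ea-t = Into.into-t ea-in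
        eb-t = Into.into-t eb-in
        distinct = (≢-by-target ea-t eb-t a≢b ∷ ≢-by-target ea-t (Into.into-t g-in) a≢pa ∷ []) ∷
                   (≢-by-target eb-t (Into.into-t g-in) b≢pa ∷ []) ∷ [] ∷ []

      pb≢v : pb ≢ v
      pb≢v pb≡v = <⇒≱ (deg-≥ N₀ distinct ((Invariant.hi∈ inv₀ , at-t refl) ∷ (Invariant.he∈ inv₀ , at-t same-t) ∷
                                            (eb∈₀ , at-s pb≡v) ∷ []))
                        (subst (λ x → deg N₀ x ≤ 2) pb≡v deg≤2)
        where
        eb-off = not-arcˢ λ pb≡u → s≢t (trans (sym pb≡u) pb≡v)
        distinct = (hi≢he ∷ (proj₁ eb-off ∘ sym) ∷ []) ∷ ((proj₂ eb-off ∘ sym) ∷ []) ∷ [] ∷ []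

      ¬pb-ea : ¬ At pb ea
      ¬pb-ea (at-s pa≡pb) = pa≢pb pa≡pb
      ¬pb-ea (at-t a≡pb) = a≢pb (trans (sym (Into.into-t ea-in)) a≡pb)

      ¬pb-g : ¬ At pb g
      ¬pb-g (at-t g≡pb) = pa≢pb (trans (sym (Into.into-t g-in)) g≡pb)
      ¬pb-g (at-s s≡pb) with SuppressOK.single-out ok₀ g∈₀ (outOf (Into.into-dir g-in) s≡pb) eb∈₀ eb-out
      ... | g≡eb = ≢-by-target (Into.into-t eb-in) (Into.into-t g-in) b≢pa (sym g≡eb)

    finish : ∀ {N₁ N'} → OptSuppress N₀ pb N₁ → SuppressRel N₁ pa N' → Invariant N'
    finish (inj₂ (_ , refl)) = suppress-pa inv₀ ea∈₀ g∈₀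
    finish (inj₁ (suppressible , sr₀)) =
      suppress-pa (invariant-suppression inv₀ sup₀ (ok₀ suppressible) pb≢u (pb≢v suppressible))
                  (suppression-edges⁺ sup₀ ea∈₀ (¬pb-ea suppressible)) (suppression-edges⁺ sup₀ g∈₀ (¬pb-g suppressible))
      where
      sup₀ = suppression sr₀

  step-ret : ∀ {N N' a b} → Invariant N → RetRed N a b N' → Invariant N' ⊎ Critical N
  step-ret {N} {N'} inv (a≢b , (a∈ , a-leaf , _) , (b∈ , b-leaf , _) , ea , eb , (ea∈ , ea-dir , ea-t) ,
                         (eb∈ , eb-dir , eb-t) , hybrid , f , (f∈ , f-dir , f-s , f-t) , _ , opt , sr) =
    dispatch (eid≟ (eid f) (eid hi)) (eid≟ (eid f) (eid he))
    where
    reduces-arc : s f ≡ u → t f ≡ v → Critical N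
    reduces-arc s≡u t≡v = critical ea∈ (outOf ea-dir (trans (sym f-t) t≡v)) (into ea-dir ea-t)
                                   eb∈ (outOf eb-dir (trans (sym f-s) s≡u)) (into eb-dir eb-t) a∈ b∈ a-leaf b-leaf a≢b

    dispatch : Dec (eid f ≡ eid hi) → Dec (eid f ≡ eid he) → Invariant N' ⊎ Critical N
    dispatch (yes f≡hi) _ with eid-injective inv f∈ (Invariant.hi∈ inv) f≡hi
    ... | refl = inj₂ (reduces-arc refl refl)
    dispatch (no _) (yes f≡he) with eid-injective inv f∈ (Invariant.he∈ inv) f≡he
    ... | refl = inj₂ (reduces-arc same-s same-t)
    dispatch (no f≢hi) (no f≢he) =
      inj₁ (RetStep.finish inv a≢b a-leaf b-leaf ea∈ (into ea-dir ea-t) eb∈ (into eb-dir eb-t) hybrid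
                           f∈ (outOf f-dir f-s) (into f-dir f-t) f≢hi f≢he opt sr)

  step-reduce : ∀ {N N' c} → Invariant N → Reduce N c N' → Invariant N' ⊎ Critical N
  step-reduce inv (inj₁ tree) = inj₁ (step-tree inv tree)
  step-reduce inv (inj₂ ret) = step-ret inv ret

  run : ∀ {P : Net n → Set} {N M S} → (∀ {N'} → Invariant N' → Critical N' → P N') → Invariant N →
        (R : RedSeq N S M) → TrivialForest M → SomeBefore P R
  run {M = M} _ inv done forest = m<n⇒n≢0 (deg-≥ M ([] ∷ []) ((hi∈ , at-s refl) ∷ [])) (proj₁ (forest u u∈))
    where open Invariant inv
  run found inv (step red R) forest with step-reduce inv red
  ... | inj₁ inv' = inj₂ (run found inv' R forest)
  ... | inj₂ crit = inj₁ (found inv crit)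

  module CriticalComponent {N : Net n} (inv : Invariant N) (crit : Critical N) where

    open Invariant inv
    open Critical crit

    a≢u : a ≢ u
    a≢u = leaf≢u inv a-leaf

    a≢v : a ≢ v
    a≢v = leaf≢v inv a-leaf

    b≢u : b ≢ u
    b≢u = leaf≢u inv b-leaf

    b≢v : b ≢ v
    b≢v = leaf≢v inv b-leaf

    ea-s : s ea ≡ v
    ea-s = OutOf.out-s ea-out

    ea-t : t ea ≡ a
    ea-t = Into.into-t ea-in

    eb-s : s eb ≡ u
    eb-s = OutOf.out-s eb-out

    eb-t : t eb ≡ b
    eb-t = Into.into-t eb-in

    -- In the order of the nodes 0 to 3 and the edges base 0 to base 3 of N₂.
    KN : List ℕ
    KN = u ∷ v ∷ a ∷ b ∷ []

    KE : List Edge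
    KE = eb ∷ hi ∷ he ∷ ea ∷ []

    K : Net n
    K = net KN KE (lab N)

    KE⊆ : ∀ {e} → e ∈ KE → e ∈ edges N
    KE⊆ (here refl) = eb∈
    KE⊆ (there (here refl)) = hi∈
    KE⊆ (there (there (here refl))) = he∈
    KE⊆ (there (there (there (here refl)))) = ea∈

    u∈K : u ∈ KN
    u∈K = here refl

    v∈K : v ∈ KN
    v∈K = there (here refl)

    a∈K : a ∈ KN
    a∈K = there (there (here refl))

    b∈K : b ∈ KN
    b∈K = there (there (there (here refl)))

    ends-in-KN : ∀ {e} → e ∈ KE → s e ∈ KN × t e ∈ KN
    ends-in-KN (here refl) = subst (_∈ KN) (sym eb-s) u∈K , subst (_∈ KN) (sym eb-t) b∈K
    ends-in-KN (there (here refl)) = u∈K , v∈K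
    ends-in-KN (there (there (here refl))) = subst (_∈ KN) (sym same-s) u∈K , subst (_∈ KN) (sym same-t) v∈K
    ends-in-KN (there (there (there (here refl)))) = subst (_∈ KN) (sym ea-s) v∈K , subst (_∈ KN) (sym ea-t) a∈K

    eb-other : Other N u hi he eb
    eb-other = let (≢hi , ≢he) = into-leaf-off-arcs inv b-leaf eb-t in other eb∈ (at-s eb-s) ≢hi ≢he

    ea-other : Other N v hi he ea
    ea-other = let (≢hi , ≢he) = into-leaf-off-arcs inv a-leaf ea-t in other ea∈ (at-s ea-s) ≢hi ≢he

    arcs-or : ∀ {x o e} {P : Edge → Set} → ThirdEdge N x hi he P → Other N x hi he o →
              e ∈ edges N → At x e → e ∈ hi ∷ he ∷ o ∷ []
    arcs-or third o e∈ at with other? {h₁ = hi} {he} e∈ at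
    ... | inj₁ refl = here refl
    ... | inj₂ (inj₁ refl) = there (here refl)
    ... | inj₂ (inj₂ o') = there (there (here (ThirdEdge.other-unique third o' o)))

    edges-at-KN : ∀ {w e} → w ∈ KN → e ∈ edges N → At w e → e ∈ KE
    edges-at-KN (here refl) e∈ at with arcs-or third-u eb-other e∈ at
    ... | here refl = there (here refl)
    ... | there (here refl) = there (there (here refl))
    ... | there (there (here refl)) = here refl
    edges-at-KN (there (here refl)) e∈ at with arcs-or third-v ea-other e∈ at
    ... | here refl = there (here refl)
    ... | there (here refl) = there (there (here refl))
    ... | there (there (here refl)) = there (there (there (here refl)))
    edges-at-KN (there (there (here refl))) e∈ at with only-parent inv a∈ a-leaf ea∈ ea-in e∈ at
    ... | refl = there (there (there (here refl)))
    edges-at-KN (there (there (there (here refl)))) e∈ at with only-parent inv b∈ b-leaf eb∈ eb-in e∈ at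
    ... | refl = here refl

    reaches-KN : ∀ {w} → w ∈ KN → Conn N u w
    reaches-KN (here refl) = ε
    reaches-KN (there (here refl)) = edge-conn {N = N} hi∈
    reaches-KN (there (there (here refl))) = edge-conn {N = N} hi∈ ◅◅ subst₂ (Conn N) ea-s ea-t (edge-conn {N = N} ea∈)
    reaches-KN (there (there (there (here refl)))) = subst₂ (Conn N) eb-s eb-t (edge-conn {N = N} eb∈)

    closed : ∀ {x w} → x ∈ KN → Conn N x w → w ∈ KN
    closed x∈ ε = x∈
    closed x∈ (adj ◅ path) with find adj
    ... | e , e∈ , inj₁ (s≡x , t≡y) = closed (subst (_∈ KN) t≡y (proj₂ (ends-in-KN (edges-at-KN x∈ e∈ (at-s s≡x))))) path
    ... | e , e∈ , inj₂ (s≡y , t≡x) = closed (subst (_∈ KN) s≡y (proj₁ (ends-in-KN (edges-at-KN x∈ e∈ (at-t t≡x))))) path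

    nodes-in-N : ∀ {w} → w ∈ KN → w ∈ nodes N
    nodes-in-N (here refl) = u∈
    nodes-in-N (there (here refl)) = v∈
    nodes-in-N (there (there (here refl))) = a∈
    nodes-in-N (there (there (there (here refl)))) = b∈

    component : ComponentOf N K
    component = u , here refl , (λ _ w∈ → nodes-in-N w∈ , reaches-KN w∈) , (λ _ _ → closed (here refl)) ,
                (λ _ e∈ → KE⊆ e∈ , ends-in-KN e∈) ,
                (λ _ e∈ s∈ → edges-at-KN s∈ e∈ (at-s refl)) , (λ _ e∈ t∈ → edges-at-KN t∈ e∈ (at-t refl))

    fK : ℕ → ℕ
    fK x = select (x ≟ u) 0 (select (x ≟ v) 1 (select (x ≟ a) 2 3))

    gK : ℕ → ℕ
    gK 0 = u
    gK 1 = v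
    gK 2 = a
    gK _ = b

    fK-u : fK u ≡ 0
    fK-u = select-yes (u ≟ u) refl

    fK-v : fK v ≡ 1
    fK-v = trans (select-no (v ≟ u) (s≢t ∘ sym)) (select-yes (v ≟ v) refl)

    fK-a : fK a ≡ 2
    fK-a = trans (select-no (a ≟ u) a≢u) (trans (select-no (a ≟ v) a≢v) (select-yes (a ≟ a) refl))

    fK-b : fK b ≡ 3
    fK-b = trans (select-no (b ≟ u) b≢u) (trans (select-no (b ≟ v) b≢v) (select-no (b ≟ a) (a≢b ∘ sym)))

    φK : EId → EId
    φK i = select (eid≟ i (eid eb)) (base 0) (select (eid≟ i (eid hi)) (base 1) (select (eid≟ i (eid he)) (base 2) (base 3)))

    ψK : EId → EId
    ψK (base 0) = eid eb
    ψK (base 1) = eid hi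
    ψK (base 2) = eid he
    ψK _ = eid ea

    ids≢ : ∀ {e e'} → e ∈ edges N → e' ∈ edges N → e ≢ e' → eid e ≢ eid e'
    ids≢ e∈ e'∈ e≢e' eq = e≢e' (eid-injective inv e∈ e'∈ eq)

    φK-eb : φK (eid eb) ≡ base 0
    φK-eb = select-yes (eid≟ (eid eb) (eid eb)) refl

    φK-hi : φK (eid hi) ≡ base 1
    φK-hi = trans (select-no (eid≟ (eid hi) (eid eb)) (ids≢ hi∈ eb∈ (≢-by-target refl eb-t (b≢v ∘ sym))))
                  (select-yes (eid≟ (eid hi) (eid hi)) refl)

    φK-he : φK (eid he) ≡ base 2
    φK-he = trans (select-no (eid≟ (eid he) (eid eb)) (ids≢ he∈ eb∈ (≢-by-target same-t eb-t (b≢v ∘ sym))))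
                  (trans (select-no (eid≟ (eid he) (eid hi)) (ids≢ he∈ hi∈ (hi≢he ∘ sym)))
                         (select-yes (eid≟ (eid he) (eid he)) refl))

    φK-ea : φK (eid ea) ≡ base 3
    φK-ea = trans (select-no (eid≟ (eid ea) (eid eb)) (ids≢ ea∈ eb∈ (≢-by-target ea-t eb-t a≢b)))
                  (trans (select-no (eid≟ (eid ea) (eid hi)) (ids≢ ea∈ hi∈ (≢-by-source ea-s refl (s≢t ∘ sym))))
                         (select-no (eid≟ (eid ea) (eid he)) (ids≢ ea∈ he∈ (≢-by-source ea-s same-s (s≢t ∘ sym)))))

    record Matches (e e' : Edge) : Set where
      field
        φ-eid : φK (eid e) ≡ eid e'
        ψ-eid : ψK (eid e') ≡ eid e
        dir≡  : dir e ≡ dir e'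
        s≡    : s e' ≡ fK (s e)
        t≡    : t e' ≡ fK (t e)

    matches-eb : Matches eb (edge (base 0) 0 3 true)
    matches-eb = record { φ-eid = φK-eb ; ψ-eid = refl ; dir≡ = OutOf.out-dir eb-out
                        ; s≡ = sym (trans (cong fK eb-s) fK-u) ; t≡ = sym (trans (cong fK eb-t) fK-b) }

    matches-hi : Matches hi (edge (base 1) 0 1 true)
    matches-hi = record { φ-eid = φK-hi ; ψ-eid = refl ; dir≡ = hi-dir ; s≡ = sym fK-u ; t≡ = sym fK-v }

    matches-he : Matches he (edge (base 2) 0 1 true)
    matches-he = record { φ-eid = φK-he ; ψ-eid = refl ; dir≡ = he-dir
                        ; s≡ = sym (trans (cong fK same-s) fK-u) ; t≡ = sym (trans (cong fK same-t) fK-v) }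

    matches-ea : Matches ea (edge (base 3) 1 2 true)
    matches-ea = record { φ-eid = φK-ea ; ψ-eid = refl ; dir≡ = OutOf.out-dir ea-out
                        ; s≡ = sym (trans (cong fK ea-s) fK-v) ; t≡ = sym (trans (cong fK ea-t) fK-a) }

    to-N₂ : ∀ {e} → e ∈ KE → Σ Edge λ e' → e' ∈ edges N₂ × Matches e e'
    to-N₂ (here refl) = _ , here refl , matches-eb
    to-N₂ (there (here refl)) = _ , there (here refl) , matches-hi
    to-N₂ (there (there (here refl))) = _ , there (there (here refl)) , matches-he
    to-N₂ (there (there (there (here refl)))) = _ , there (there (there (here refl))) , matches-ea

    from-N₂ : ∀ {e'} → e' ∈ edges N₂ → Σ Edge λ e → e ∈ KE × Matches e e'
    from-N₂ (here refl) = _ , here refl , matches-eb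
    from-N₂ (there (here refl)) = _ , there (here refl) , matches-hi
    from-N₂ (there (there (here refl))) = _ , there (there (here refl)) , matches-he
    from-N₂ (there (there (there (here refl)))) = _ , there (there (there (here refl))) , matches-ea

    nodes→ : ∀ x → x ∈ KN → fK x ∈ nodes N₂ × gK (fK x) ≡ x
    nodes→ _ (here refl) = subst (_∈ nodes N₂) (sym fK-u) (here refl) , cong gK fK-u
    nodes→ _ (there (here refl)) = subst (_∈ nodes N₂) (sym fK-v) (there (here refl)) , cong gK fK-v
    nodes→ _ (there (there (here refl))) = subst (_∈ nodes N₂) (sym fK-a) (there (there (here refl))) , cong gK fK-a
    nodes→ _ (there (there (there (here refl)))) =
      subst (_∈ nodes N₂) (sym fK-b) (there (there (there (here refl)))) , cong gK fK-b

    nodes← : ∀ y → y ∈ nodes N₂ → gK y ∈ KN × fK (gK y) ≡ y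
    nodes← _ (here refl) = here refl , fK-u
    nodes← _ (there (here refl)) = there (here refl) , fK-v
    nodes← _ (there (there (here refl))) = there (there (here refl)) , fK-a
    nodes← _ (there (there (there (here refl)))) = there (there (there (here refl))) , fK-b

    iso : IsoUpToLabels K N₂
    iso = fK , gK , φK , ψK , nodes→ , nodes← ,
          (λ _ e∈ → let (e' , e'∈ , m) = to-N₂ e∈ in
             trans (cong ψK (φ-eid m)) (ψ-eid m) , lose e'∈ (sym (φ-eid m) , sym (dir≡ m) , inj₁ (s≡ m , t≡ m))) ,
          (λ _ e'∈ → let (e , e∈ , m) = from-N₂ e'∈ in
             trans (cong φK (ψ-eid m)) (φ-eid m) , lose e∈ (sym (ψ-eid m) , dir≡ m , inj₁ (s≡ m , t≡ m)))
      where open Matches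

  critical-third : ∀ {N} → Invariant N → (crit : Critical N) → Q (Critical.eb crit)
  critical-third inv crit = ThirdEdge.other-P (Invariant.third-u inv) (CriticalComponent.eb-other inv crit)

  critical-component : ∀ {N} → Invariant N → Critical N →
                       Σ (Net n) λ K → ComponentOf N K × IsoUpToLabels K N₂ × HasEdge K hi × HasEdge K he
  critical-component inv crit = K , component , iso , there (here refl) , there (there (here refl))
    where open CriticalComponent inv crit

module _ {n} {N : Net n} (sdag : SDAG N) where

  sd-forward : ∀ e → SDStep N e (s e) (t e)
  sd-forward e with dir e in d
  ... | true = inj₁ (refl , refl , refl)
  ... | false = inj₂ (refl , inj₁ (refl , refl))

  no-loop : ∀ {e} → e ∈ edges N → s e ≢ t e
  no-loop {e} e∈ s≡t =
    sdag (s e , e , [] , s e ∷ [] , cons e∈ (subst (SDStep N e (s e)) (sym s≡t) (sd-forward e)) [] , [] ∷ [] , [] ∷ [])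

  no-2-cycle : ∀ {e f x y} → e ∈ edges N → f ∈ edges N → eid e ≢ eid f → x ≢ y →
               SDStep N e x y → SDStep N f y x → ⊥
  no-2-cycle e∈ f∈ ids≢ x≢y e-step f-step =
    sdag (_ , _ , _ ∷ [] , _ ∷ _ ∷ [] , cons e∈ e-step (cons f∈ f-step []) , (ids≢ ∷ []) ∷ [] ∷ [] , (x≢y ∷ []) ∷ [] ∷ [])

  parallel⇒arcs : ∀ {hi he} → hi ∈ edges N → he ∈ edges N → Parallel hi he → ParallelArcs hi he
  parallel⇒arcs {hi} {he} hi∈ he∈ (ids≢ , inj₂ (s≡t , t≡s)) = ⊥-elim
    (no-2-cycle hi∈ he∈ ids≢ (no-loop hi∈) (sd-forward hi) (subst₂ (SDStep N he) (sym t≡s) (sym s≡t) (sd-forward he)))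
  parallel⇒arcs {hi} {he} hi∈ he∈ (ids≢ , inj₁ (s≡s , t≡t)) with dir hi in d-hi | dir he in d-he
  ... | false | _ = ⊥-elim (no-2-cycle he∈ hi∈ (ids≢ ∘ sym) (no-loop hi∈)
          (subst₂ (SDStep N he) (sym s≡s) (sym t≡t) (sd-forward he)) (inj₂ (d-hi , inj₂ (refl , refl))))
  ... | true | false = ⊥-elim (no-2-cycle hi∈ he∈ ids≢ (no-loop hi∈)
          (sd-forward hi) (subst₂ (SDStep N he) (sym t≡t) (sym s≡s) (inj₂ (d-he , inj₂ (refl , refl)))))
  ... | true | true = record
    { hi-dir = d-hi ; he-dir = d-he ; same-s = sym s≡s ; same-t = sym t≡t ; s≢t = no-loop hi∈
    ; hi≢he = λ hi≡he → ids≢ (cong eid hi≡he) }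

someBefore-⊥ : ∀ {n} {N M : Net n} {S} (R : RedSeq N S M) → ¬ SomeBefore (λ _ → ⊥) R
someBefore-⊥ (step _ R) (inj₂ later) = someBefore-⊥ R later

EnteringFromElsewhere : ℕ → Edge → Set
EnteringFromElsewhere x e = Into x e × s e ≢ x

entering-stable : ∀ {x} → MergeStable (EnteringFromElsewhere x) x
entering-stable y≢x l₁ _ ¬out₁ (inj₁ ((into d t≡x , s≢x) , _ , _)) with l₁
... | forward s≡y _ = ⊥-elim (¬out₁ (outOf d s≡y))
... | backward _ t≡y = ⊥-elim (y≢x (trans (sym t≡y) t≡x))
entering-stable {x} y≢x l₁ l₂ _ (inj₂ ((into d t≡x , _) , _ , ¬at₁)) with l₂
... | backward _ t≡y = ⊥-elim (y≢x (trans (sym t≡y) t≡x))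
... | forward s≡y t≡w = into (trans (cong (λ b → b ∧ _) d) (T⇒≡true (T-≡ᵇ⁺ s≡y))) (trans (sym t≡w) t≡x) ,
                        λ u≡x → ¬at₁ (subst (λ z → At z _) u≡x (links-atʳ l₁))

module _ {n} {N : Net n} (lnet : LNetwork N) (bin : Binary N) (all-base : AllBase N)
         {hi he : Edge} (hi∈ : hi ∈ edges N) (he∈ : he ∈ edges N) (arcs : ParallelArcs hi he) where

  open ParallelArcs arcs

  private
    u : ℕ
    u = s hi

    sdag : SDAG N
    sdag = LNetwork.sdag lnet

  u∈ : u ∈ nodes N
  u∈ = WellFormed.srcIn (LNetwork.wf lnet) hi∈

  u-deg≤3 : deg N u ≤ 3
  u-deg≤3 = binary-deg≤3 N bin u∈ (exit⇒¬leaf N hi∈ (exits-out (outOf hi-dir refl)))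

  third-at-u : ∀ {P : Edge → Set} → (∀ {e} → Other N u hi he e → P e) → ThirdEdge N u hi he P
  third-at-u = third-edge N u-deg≤3 hi∈ (at-s refl) he∈ (at-s same-s) hi≢he

  reduction-meets-N₂ : (S : List (ℕ × ℕ)) (M : Net n) (R : RedSeq N S M) → TrivialForest M →
                       SomeBefore (λ M' → Σ (Net n) λ K →
                         ComponentOf M' K × IsoUpToLabels K N₂ × HasEdge K hi × HasEdge K he) R
  reduction-meets-N₂ _ _ R forest =
    run critical-component (initial lnet bin all-base hi∈ he∈ (third-at-u (λ _ → tt))) R forest
    where open Tracking arcs (λ _ → ⊤) (λ _ _ _ _ _ → tt)

  -- An entering third edge at u keeps entering u, while a critical
  -- configuration needs an edge from u to a leaf.
  ¬orchard-if-entering : ThirdEdge N u hi he (EnteringFromElsewhere u) → ¬ Orchard N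
  ¬orchard-if-entering third (_ , _ , R , forest) =
    someBefore-⊥ R (run (λ inv crit → proj₂ (critical-third inv crit) (OutOf.out-s (Critical.eb-out crit)))
                        (initial lnet bin all-base hi∈ he∈ third) R forest)
    where open Tracking arcs (EnteringFromElsewhere u) entering-stable

  undirected-neighbour : ∀ {o} → o ∈ edges N → dir o ≡ false → At u o → Σ ℕ λ x → x ∈ nodes N × x ≢ u × _∼_ N u x
  undirected-neighbour {o} o∈ d (at-s s≡u) =
    t o , WellFormed.tgtIn (LNetwork.wf lnet) o∈ , (λ t≡u → no-loop sdag o∈ (trans s≡u (sym t≡u))) ,
    lose o∈ (d , inj₁ (s≡u , refl)) ◅ ε
  undirected-neighbour {o} o∈ d (at-t t≡u) =
    s o , WellFormed.srcIn (LNetwork.wf lnet) o∈ , (λ s≡u → no-loop sdag o∈ (trans s≡u (sym t≡u))) ,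
    lose o∈ (d , inj₂ (refl , t≡u)) ◅ ε

  unresolved-if-undirected : Complete N → ∀ {o} → o ∈ edges N → dir o ≡ false → At u o → UnresolvedRootComp N u
  unresolved-if-undirected comp o∈ d at with undirected-neighbour o∈ d at
  ... | x , x∈ , x≢u , u∼x =
    (u∈ , Complete.nontrivClassNoIn comp u x u∈ x∈ u∼x x≢u) , λ ((_ , trivial) , _) → x≢u (trivial x x∈ u∼x)

  unresolved-if-three-out : ∀ {o} → Other N u hi he o → OutOf u o → UnresolvedRootComp N u
  unresolved-if-three-out {o} o-other o-out = (u∈ , no-incoming) , λ (_ , small) → <⇒≱ three (deg≤2 small)
    where
    open Other o-other
    all-out : ∀ {e} → e ∈ edges N → At u e → OutOf u e
    all-out e∈ at with other? {h₁ = hi} {he} e∈ at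
    ... | inj₁ refl = outOf hi-dir refl
    ... | inj₂ (inj₁ refl) = outOf he-dir same-s
    ... | inj₂ (inj₂ e-other) = subst (OutOf u) (sym (ThirdEdge.other-unique (third-at-u (λ _ → tt)) e-other o-other)) o-out

    no-incoming : ¬ ClassHasIncoming N u
    no-incoming incoming with find incoming
    ... | e , e∈ , _ , u∼t with class-trivial N (λ e∈ at → OutOf.out-dir (all-out e∈ at)) u∼t
    ...   | t≡u = no-loop sdag e∈ (trans (OutOf.out-s (all-out e∈ (at-t t≡u))) (sym t≡u))

    three : 3 ≤ deg N u
    three = deg-≥ N ((hi≢he ∷ (other≢₁ ∘ sym) ∷ []) ∷ ((other≢₂ ∘ sym) ∷ []) ∷ [] ∷ [])
                    ((hi∈ , at-s refl) ∷ (he∈ , at-s same-s) ∷ (other∈ , other-at) ∷ [])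

    deg≤2 : deg N u ≡ 0 ⊎ deg N u ≡ 2 → deg N u ≤ 2
    deg≤2 (inj₁ deg≡0) = subst (_≤ 2) (sym deg≡0) z≤n
    deg≤2 (inj₂ deg≡2) = ≤-reflexive deg≡2

  u-unresolved : Complete N → Orchard N → UnresolvedRootComp N u
  u-unresolved comp orchard with any? (λ e → at? u e ×-dec ¬? (edge≟ e hi) ×-dec ¬? (edge≟ e he)) (edges N)
  ... | no none = ⊥-elim (¬orchard-if-entering (third-at-u vacuous) orchard)
    where
    vacuous : ∀ {e} → Other N u hi he e → EnteringFromElsewhere u e
    vacuous (other e∈ at e≢hi e≢he) = ⊥-elim (none (lose e∈ (at , e≢hi , e≢he)))
  ... | yes some with find some
  ...   | o , o∈ , at , o≢hi , o≢he with dir o in d | at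
  ...     | false | _ = unresolved-if-undirected comp o∈ d at
  ...     | true | at-s s≡u = unresolved-if-three-out (other o∈ at o≢hi o≢he) (outOf d s≡u)
  ...     | true | at-t t≡u = ⊥-elim (¬orchard-if-entering (third-at-u entering) orchard)
    where
    entering : ∀ {e} → Other N u hi he e → EnteringFromElsewhere u e
    entering e-other =
      subst (EnteringFromElsewhere u) (ThirdEdge.other-unique (third-at-u (λ _ → tt)) (other o∈ at o≢hi o≢he) e-other)
                         (into d t≡u , λ s≡u → no-loop sdag o∈ (trans s≡u (sym t≡u)))

  unresolved-root-component : Complete N → Orchard N →
                              Σ ℕ λ w → UnresolvedRootComp N w × InAdm N w hi × InAdm N w he
  unresolved-root-component comp orchard =
    u , u-unresolved comp orchard , (hi∈ , inj₂ (inj₁ ε)) , (he∈ , inj₂ (inj₁ (subst (_∼_ N u) (sym same-s) ε)))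

proposition3 : ∀ {n : ℕ} (N : Net n) →
    LNetwork N → Complete N → Binary N → Orchard N → AllBase N →
    (hi he : Edge) → hi ∈ edges N → he ∈ edges N → Parallel hi he →
    ((S : List (ℕ × ℕ)) (M : Net n) (R : RedSeq N S M) → TrivialForest M →
       SomeBefore (λ M' → Σ (Net n) λ K →
         ComponentOf M' K × IsoUpToLabels K N₂ × HasEdge K hi × HasEdge K he) R)
    ×
    Σ ℕ (λ v → UnresolvedRootComp N v × InAdm N v hi × InAdm N v he)
proposition3 N lnet comp bin orchard all-base hi he hi∈ he∈ parallel =
  reduction-meets-N₂ lnet bin all-base hi∈ he∈ arcs , unresolved-root-component lnet bin all-base hi∈ he∈ arcs comp orchard
  where
  arcs : ParallelArcs hi he
  arcs = parallel⇒arcs (LNetwork.sdag lnet) hi∈ he∈ parallel
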